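{- The TRS $\mathcal{R}_4$ is not incrementally polynomially terminating over $\mathbb{Q}$, and it is not incrementally polynomially terminating over $\mathbb{N}$.
   Context: Signature: constant $\mathsf{0}$, unary $\mathsf{s},\mathsf{f},\mathsf{g},\mathsf{k}$, binary $\mathsf{h}$. $\mathcal{R}_4$ consists of the rules: $\mathsf{f}(\mathsf{g}(x))\to\mathsf{g}(\mathsf{g}(\mathsf{f}(x)))$; $\mathsf{g}(\mathsf{s}(x))\to\mathsf{s}(\mathsf{s}(\mathsf{g}(x)))$; $\mathsf{g}(x)\to\mathsf{h}(x,x)$; $\mathsf{s}(x)\to\mathsf{h}(\mathsf{0},x)$; $\mathsf{s}(x)\to\mathsf{h}(x,\mathsf{0})$; $\mathsf{k}(\mathsf{k}(\mathsf{k}(x)))\to\mathsf{h}(\mathsf{k}(x),\mathsf{k}(x))$; $\mathsf{s}(\mathsf{h}(\mathsf{k}(x),\mathsf{k}(x)))\to\mathsf{k}(\mathsf{k}(\mathsf{k}(x)))$. For $D=\mathbb{Q}$: $\mathbb{Q}_0=\{x\in\mathbb{Q}:x\ge0\}$; a polynomial interpretation over $\mathbb{Q}$ consists of rational $\delta>0$ and for each $n$-ary symbol $f$ a polynomial $f_\mathbb{Q}\in\mathbb{Q}[x_1,\dots,x_n]$ with $f_\mathbb{Q}(\mathbb{Q}_0^n)\subseteq\mathbb{Q}_0$; strict order $x>y$ iff $x-y\ge\delta$ on $\mathbb{Q}_0$, weak order $\ge$ on $\mathbb{Q}_0$. For $D=\mathbb{N}$: an interpretation assigns $f_\mathbb{N}\in\mathbb{Z}[x_1,\dots,x_n]$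 with $f_\mathbb{N}(\mathbb{N}^n)\subseteq\mathbb{N}$, strictly monotone w.r.t. standard $>$ on $\mathbb{N}$; strict order $>$, weak order $\ge$ on $\mathbb{N}$. An interpretation is strictly (weakly) monotone if every interpretation function is monotone in each argument w.r.t. the strict (weak) order, and (weakly) compatible with a TRS if $[\alpha](\ell)>[\alpha](r)$ ($\ge$) for all rules and all assignments into the carrier. A TRS $\mathcal{R}$ is polynomially terminating over $D$ if some strictly monotone polynomial interpretation over $D$ is compatible with it. For $n\ge1$, $\mathcal{R}$ is polynomially terminating over $D$ in $n$ steps if either $n=1$ and $\mathcal{R}$ is polynomially terminating over $D$, or $n>1$ and there are a polynomial interpretation $\mathcal{P}$ over $D$ and nonempty $\mathcal{S}\subsetneq\mathcal{R}$ such that $\mathcal{P}$ is weakly and strictly monotone, weakly compatible with all rules of $\mathcal{R}$, compatible with all rules of $\mathcal{S}$, and $\mathcal{R}\setminus\mathcal{S}$ is polynomially terminating over $D$ in $n-1$ steps. $\mathcal{R}$ is incrementally polynomially terminating over $D$ if this holds for some $n\ge1$. -}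

module Defs where

open import Data.Nat using (ℕ; zero; suc)
open import Data.Fin using (Fin)
open import Data.Product using (_×_; _,_; Σ; ∃)
open import Data.List using (List; []; _∷_)
open import Data.List.Membership.Propositional using (_∈_)
open import Relation.Nullary using (¬_)
import Data.Rational as Q
import Data.Integer as Z

data Term : Set where
  var : ℕ → Term
  𝟎   : Term
  s   : Term → Term
  f   : Term → Term
  g   : Term → Term
  k   : Term → Term
  h   : Term → Term → Term

Rule : Set
Rule = Term × Term

TRS : Set₁
TRS = Rule → Set

_⊆_ : TRS → TRS → Set
S ⊆ R = ∀ r → S r → R r

_∖_ : TRS → TRS → TRS
(R ∖ S) r = R r × ¬ S r

x : Term
x = var 0

R₄rules : List Rule
R₄rules =
    (f (g x) , g (g (f x)))
  ∷ (g (s x) , s (s (g x)))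
  ∷ (g x , h x x)
  ∷ (s x , h 𝟎 x)
  ∷ (s x , h x 𝟎)
  ∷ (k (k (k x)) , h (k x) (k x))
  ∷ (s (h (k x) (k x)) , k (k (k x)))
  ∷ []

R₄ : TRS
R₄ r = r ∈ R₄rules

record Alg (C : Set) : Set where
  field
    a0 : C
    as af ag ak : C → C
    ah : C → C → C

open Alg public

⟦_⟧ : {C : Set} → Alg C → (ℕ → C) → Term → C
⟦ A ⟧ α (var n) = α n
⟦ A ⟧ α 𝟎 = a0 A
⟦ A ⟧ α (s t) = as A (⟦ A ⟧ α t)
⟦ A ⟧ α (f t) = af A (⟦ A ⟧ α t)
⟦ A ⟧ α (g t) = ag A (⟦ A ⟧ α t)
⟦ A ⟧ α (k t) = ak A (⟦ A ⟧ α t)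
⟦ A ⟧ α (h t u) = ah A (⟦ A ⟧ α t) (⟦ A ⟧ α u)

Closed : {C : Set} → (C → Set) → Alg C → Set
Closed Dom A =
    Dom (a0 A)
  × (∀ y → Dom y → Dom (as A y))
  × (∀ y → Dom y → Dom (af A y))
  × (∀ y → Dom y → Dom (ag A y))
  × (∀ y → Dom y → Dom (ak A y))
  × (∀ y z → Dom y → Dom z → Dom (ah A y z))

MonoUnary : {C : Set} → (C → Set) → (C → C → Set) → (C → C) → Set
MonoUnary Dom _≻_ F = ∀ y y′ → Dom y → Dom y′ → y ≻ y′ → F y ≻ F y′

Monotone : {C : Set} → (C → Set) → (C → C → Set) → Alg C → Set
Monotone Dom _≻_ A =
    MonoUnary Dom _≻_ (as A)
  × MonoUnary Dom _≻_ (af A)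
  × MonoUnary Dom _≻_ (ag A)
  × MonoUnary Dom _≻_ (ak A)
  × (∀ z → Dom z → MonoUnary Dom _≻_ (λ y → ah A y z))
  × (∀ z → Dom z → MonoUnary Dom _≻_ (λ y → ah A z y))

Compatible : {C : Set} → (C → Set) → (C → C → Set) → Alg C → TRS → Set
Compatible {C} Dom _≻_ A R =
  ∀ l r → R (l , r) → (α : ℕ → C) → (∀ n → Dom (α n)) → ⟦ A ⟧ α l ≻ ⟦ A ⟧ α r

-- Generic notion of (incremental) polynomial termination, parametrised by
-- a class of interpretations PI, each yielding an algebra over C, a
-- carrier Dom ⊆ C, a strict order (may depend on the interpretation,
-- e.g. via δ) and a weak order.

module Termination
  {PI : Set} {C : Set} (alg : PI → Alg C) (Dom : C → Set)
  (Gt : PI → C → C → Set) (Ge : C → C → Set) where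

  StrictlyMonotone : PI → Set
  StrictlyMonotone P = Monotone Dom (Gt P) (alg P)

  WeaklyMonotone : PI → Set
  WeaklyMonotone P = Monotone Dom Ge (alg P)

  PolyTerminating : TRS → Set
  PolyTerminating R = Σ PI λ P → StrictlyMonotone P × Compatible Dom (Gt P) (alg P) R

  data PolyTermIn (R : TRS) : ℕ → Set₁ where
    one  : PolyTerminating R → PolyTermIn R 1
    step : ∀ {n} (P : PI) (S : TRS) →
           S ⊆ R → ∃ S → ∃ (λ r → R r × ¬ S r) →
           WeaklyMonotone P → StrictlyMonotone P →
           Compatible Dom Ge (alg P) R →
           Compatible Dom (Gt P) (alg P) S →
           PolyTermIn (R ∖ S) n →
           PolyTermIn R (suc n)

  IncrPolyTerminating : TRS → Set₁
  IncrPolyTerminating R = Σ ℕ (PolyTermIn R)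

-- Polynomials in n variables with coefficients in A (syntax; every
-- polynomial of A[x₁,…,xₙ] is denoted by some expression).

data Poly (A : Set) (n : ℕ) : Set where
  con  : A → Poly A n
  pvar : Fin n → Poly A n
  _⊕_  : Poly A n → Poly A n → Poly A n
  _⊗_  : Poly A n → Poly A n → Poly A n

evalP : {A : Set} {n : ℕ} → (A → A → A) → (A → A → A) → Poly A n → (Fin n → A) → A
evalP _+_ _*_ (con c) ρ = c
evalP _+_ _*_ (pvar i) ρ = ρ i
evalP _+_ _*_ (p ⊕ q) ρ = evalP _+_ _*_ p ρ + evalP _+_ _*_ q ρ
evalP _+_ _*_ (p ⊗ q) ρ = evalP _+_ _*_ p ρ * evalP _+_ _*_ q ρ

record Polys (A : Set) : Set where
  field
    p0 : Poly A 0
    ps pf pg pk : Poly A 1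
    ph : Poly A 2

module _ {A : Set} (_+_ _*_ : A → A → A) where
  toAlg : Polys A → Alg A
  toAlg P = record
    { a0 = ev (Polys.p0 P) (λ ())
    ; as = un (Polys.ps P) ; af = un (Polys.pf P)
    ; ag = un (Polys.pg P) ; ak = un (Polys.pk P)
    ; ah = λ y z → ev (Polys.ph P) (λ { Fin.zero → y ; (Fin.suc Fin.zero) → z }) }
    where
    ev : ∀ {n} → Poly A n → (Fin n → A) → A
    ev = evalP _+_ _*_
    un : Poly A 1 → A → A
    un p y = ev p (λ _ → y)

ℚ₀ : Q.ℚ → Set
ℚ₀ q = Q.0ℚ Q.≤ q

record QInterp : Set where
  field
    δ      : Q.ℚ
    δ-pos  : Q.0ℚ Q.< δ
    polys  : Polys Q.ℚ
    closed : Closed ℚ₀ (toAlg Q._+_ Q._*_ polys)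

algℚ : QInterp → Alg Q.ℚ
algℚ P = toAlg Q._+_ Q._*_ (QInterp.polys P)

Gtℚ : QInterp → Q.ℚ → Q.ℚ → Set
Gtℚ P y z = QInterp.δ P Q.≤ y Q.- z

Geℚ : Q.ℚ → Q.ℚ → Set
Geℚ y z = z Q.≤ y

module OverQ = Termination algℚ ℚ₀ Gtℚ Geℚ

-- Over ℕ: integer polynomials mapping ℕ into ℕ; ℕ is represented as the
-- non-negative integers, with the standard orders.

ℕ₀ : Z.ℤ → Set
ℕ₀ y = Z.0ℤ Z.≤ y

record NInterp : Set where
  field
    polys  : Polys Z.ℤ
    closed : Closed ℕ₀ (toAlg Z._+_ Z._*_ polys)

algℕ : NInterp → Alg Z.ℤ
algℕ P = toAlg Z._+_ Z._*_ (NInterp.polys P)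

Gtℕ : NInterp → Z.ℤ → Z.ℤ → Set
Gtℕ _ y z = z Z.< y

Geℕ : Z.ℤ → Z.ℤ → Set
Geℕ y z = z Z.≤ y

module OverN = Termination algℕ ℕ₀ Gtℕ Geℕ

-- The first step of an incremental proof is a strictly monotone
-- interpretation that is weakly compatible with all of R₄.  Over ℚ (strict
-- order: difference ≥ δ), and over ℕ after embedding the integer
-- coefficients into ℚ (δ = 1), this gives a "monotone model": polynomials
-- over ℚ, closed and δ-monotone on a set Dom ⊆ ℚ₀ containing the grid δℕ,
-- weakly compatible with R₄.  No such model exists: comparing growth rates
-- at large grid points, the rules force the interpretations of g, s, k and
-- the diagonal of h to be affine, and the slope m of k to satisfy m² = 2.
module Submission where

open import Data.Nat as N using (ℕ; zero; suc)
import Data.Nat.Properties as NP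
open import Data.Integer as Z using (ℤ)
import Data.Integer.Properties as ZP
open import Data.Fin as Fin using (Fin)
open import Data.Bool using (Bool; true; false; _∧_; if_then_else_)
open import Data.Bool.Properties using (∧-zeroʳ)
open import Data.List using (List; []; _∷_)
open import Data.Product using (Σ; _×_; _,_; proj₁; proj₂)
open import Data.Sum using (inj₁; inj₂)
open import Data.Empty using (⊥; ⊥-elim)
open import Data.Rational
open import Data.Rational.Properties
import Data.Rational.Unnormalised as U
import Data.Rational.Unnormalised.Properties as UP
open import Data.Rational.Solver using (module +-*-Solver)
open import Algebra.Bundles using (CommutativeRing)
open import Algebra.Properties.CommutativeSemiring.Exp
  (CommutativeRing.commutativeSemiring +-*-commutativeRing)
  using (_^_; ^-homo-*; ^-assocʳ; ^-distrib-*)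
open import Relation.Binary.PropositionalEquality
open import Relation.Nullary using (¬_; does; yes; no)
open import Relation.Binary.Definitions using (tri<; tri≈; tri>)
open import Data.List.Membership.Propositional using (_∈_)
open import Data.List.Relation.Unary.Any using (here; there)
open import Defs
  using ( Poly; con; pvar; _⊕_; _⊗_; evalP; Polys; toAlg; Alg; a0; as; af; ag; ak; ah; ⟦_⟧
        ; MonoUnary; Closed; Monotone; Compatible; R₄; R₄rules; module Termination
        ; QInterp; algℚ; ℚ₀; Gtℚ; Geℚ; module OverQ; NInterp; algℕ; ℕ₀; Gtℕ; Geℕ; module OverN )
import Defs
open +-*-Solver using (solve; _:=_; _:+_; _:*_; _:-_; :-_; con)

0≤-diff : ∀ {x y} → x ≤ y → 0ℚ ≤ y - x
0≤-diff {x} x≤y = ≤-trans (≤-reflexive (sym (+-inverseʳ x))) (+-monoˡ-≤ (- x) x≤y)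

diff-0≤ : ∀ {x y} → 0ℚ ≤ y - x → x ≤ y
diff-0≤ {x} {y} 0≤y-x = begin
  x            ≡⟨ sym (+-identityˡ x) ⟩
  0ℚ + x       ≤⟨ +-monoˡ-≤ x 0≤y-x ⟩
  (y - x) + x  ≡⟨ solve 2 (λ x y → (y :- x) :+ x := y) refl x y ⟩
  y            ∎
  where open ≤-Reasoning

-- All linear rearrangements of inequalities go through this lemma: if
-- a ≤ b and y - x is, by the ring laws, equal to b - a, then x ≤ y.
≤-rearrange : ∀ {a b x y} → a ≤ b → y - x ≡ b - a → x ≤ y
≤-rearrange a≤b eq = diff-0≤ (subst (0ℚ ≤_) (sym eq) (0≤-diff a≤b))

0<1 : 0ℚ < 1ℚ
0<1 = *<* (Z.+<+ (N.s≤s N.z≤n))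

gap-absurd : ∀ {x y} → x ≤ y → y + 1ℚ ≤ x → ⊥
gap-absurd {x} {y} x≤y y+1≤x = <-irrefl refl (begin-strict
  y         ≡⟨ sym (+-identityʳ y) ⟩
  y + 0ℚ    <⟨ +-monoʳ-< y 0<1 ⟩
  y + 1ℚ    ≤⟨ y+1≤x ⟩
  x         ≤⟨ x≤y ⟩
  y         ∎)
  where open ≤-Reasoning

-- Sign and monotonicity facts for + and *, with explicit hypotheses in
-- place of the library's instance arguments.
+-nonNeg : ∀ {a b} → 0ℚ ≤ a → 0ℚ ≤ b → 0ℚ ≤ a + b
+-nonNeg {a} {b} 0≤a 0≤b = ≤-trans (≤-reflexive (sym (+-identityˡ 0ℚ))) (+-mono-≤ 0≤a 0≤b)

*-monoˡ-≤ : ∀ {r a b} → 0ℚ ≤ r → a ≤ b → r * a ≤ r * b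
*-monoˡ-≤ {r} 0≤r = *-monoˡ-≤-nonNeg r {{nonNegative 0≤r}}

*-monoʳ-≤ : ∀ {r a b} → 0ℚ ≤ r → a ≤ b → a * r ≤ b * r
*-monoʳ-≤ {r} 0≤r = *-monoʳ-≤-nonNeg r {{nonNegative 0≤r}}

*-nonNeg : ∀ {a b} → 0ℚ ≤ a → 0ℚ ≤ b → 0ℚ ≤ a * b
*-nonNeg {a} {b} 0≤a 0≤b = ≤-trans (≤-reflexive (sym (*-zeroˡ b))) (*-monoʳ-≤ 0≤b 0≤a)

*-pos : ∀ {a b} → 0ℚ < a → 0ℚ < b → 0ℚ < a * b
*-pos {a} {b} 0<a 0<b = positive⁻¹ (a * b) {{pos*pos⇒pos a {{positive 0<a}} b {{positive 0<b}}}}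

half-pos : ∀ {a} → 0ℚ < a → 0ℚ < a * ½
half-pos 0<a = *-pos 0<a (*<* (Z.+<+ (N.s≤s N.z≤n)))

^-nonNeg : ∀ {x} n → 0ℚ ≤ x → 0ℚ ≤ x ^ n
^-nonNeg zero    0≤x = <⇒≤ 0<1
^-nonNeg (suc n) 0≤x = *-nonNeg 0≤x (^-nonNeg n 0≤x)

^-pos : ∀ {x} n → 0ℚ < x → 0ℚ < x ^ n
^-pos zero    0<x = 0<1
^-pos (suc n) 0<x = *-pos 0<x (^-pos n 0<x)

^-monoˡ : ∀ {x y} n → 0ℚ ≤ x → x ≤ y → x ^ n ≤ y ^ n
^-monoˡ zero    0≤x x≤y = ≤-refl
^-monoˡ (suc n) 0≤x x≤y =
  ≤-trans (*-monoʳ-≤ (^-nonNeg n 0≤x) x≤y) (*-monoˡ-≤ (≤-trans 0≤x x≤y) (^-monoˡ n 0≤x x≤y))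

1≤^ : ∀ {x} n → 1ℚ ≤ x → 1ℚ ≤ x ^ n
1≤^ zero    1≤x = ≤-refl
1≤^ (suc n) 1≤x =
  ≤-trans (≤-trans (≤-reflexive (sym (*-identityʳ 1ℚ))) (*-monoʳ-≤ (<⇒≤ 0<1) 1≤x))
          (*-monoˡ-≤ (≤-trans (<⇒≤ 0<1) 1≤x) (1≤^ n 1≤x))

^-monoʳ : ∀ {x m n} → 1ℚ ≤ x → m N.≤ n → x ^ m ≤ x ^ n
^-monoʳ {x} {m} {n} 1≤x m≤n = begin
  x ^ m                  ≡⟨ sym (*-identityʳ (x ^ m)) ⟩
  x ^ m * 1ℚ             ≤⟨ *-monoˡ-≤ (^-nonNeg m (≤-trans (<⇒≤ 0<1) 1≤x)) (1≤^ (n N.∸ m) 1≤x) ⟩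
  x ^ m * x ^ (n N.∸ m)  ≡⟨ sym (^-homo-* x m (n N.∸ m)) ⟩
  x ^ (m N.+ (n N.∸ m))  ≡⟨ cong (x ^_) (NP.m+[n∸m]≡n m≤n) ⟩
  x ^ n                  ∎
  where open ≤-Reasoning

scaled-power : ∀ a w m n → (a * w ^ m) ^ n ≡ a ^ n * w ^ (m N.* n)
scaled-power a w m n = trans (^-distrib-* a (w ^ m) n) (cong (a ^ n *_) (^-assocʳ w m n))

÷-bound : ∀ {e} (0<e : 0ℚ < e) {B w} → _÷_ B e {{pos⇒nonZero e {{positive 0<e}}}} ≤ w → B ≤ e * w
÷-bound {e} 0<e {B} {w} le = begin
  B              ≡⟨ sym (*-identityʳ B) ⟩
  B * 1ℚ         ≡⟨ cong (B *_) (sym (*-inverseʳ e {{nz}})) ⟩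
  B * (e * e⁻¹)  ≡⟨ solve 3 (λ B e i → B :* (e :* i) := e :* (B :* i)) refl B e e⁻¹ ⟩
  e * (B * e⁻¹)  ≤⟨ *-monoˡ-≤ (<⇒≤ 0<e) le ⟩
  e * w          ∎
  where
  open ≤-Reasoning
  nz = pos⇒nonZero e {{positive 0<e}}
  e⁻¹ = 1/_ e {{nz}}

Eventually : (ℚ → Set) → Set
Eventually P = Σ ℚ λ Y → ∀ w → Y ≤ w → P w

Unbounded : (ℚ → Set) → Set
Unbounded P = ∀ Y → Σ ℚ λ w → Y ≤ w × P w

eventually-≥ : ∀ Y → Eventually (Y ≤_)
eventually-≥ Y = Y , λ _ Y≤w → Y≤w

eventually-∧ : ∀ {P Q} → Eventually P → Eventually Q → Eventually (λ w → P w × Q w)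
eventually-∧ (Y₁ , p) (Y₂ , q) =
  Y₁ ⊔ Y₂ , λ w le → p w (≤-trans (p≤p⊔q Y₁ Y₂) le) , q w (≤-trans (p≤q⊔p Y₁ Y₂) le)

eventually-map : ∀ {P Q : ℚ → Set} → (∀ {w} → P w → Q w) → Eventually P → Eventually Q
eventually-map P⇒Q (Y , p) = Y , λ w le → P⇒Q (p w le)

eventually-scaled : ∀ {e} → 0ℚ < e → ∀ B → Eventually (λ w → B ≤ e * w)
eventually-scaled {e} 0<e B = _ , λ w le → ÷-bound 0<e {B} {w} le

unbounded-∧ : ∀ {P Q} → Eventually P → Unbounded Q → Unbounded (λ w → P w × Q w)
unbounded-∧ (Y₀ , p) U Y with U (Y₀ ⊔ Y)
... | w , le , q = w , ≤-trans (p≤q⊔p Y₀ Y) le , p w (≤-trans (p≤p⊔q Y₀ Y) le) , q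

unbounded-map : ∀ {P Q : ℚ → Set} → (∀ {w} → P w → Q w) → Unbounded P → Unbounded Q
unbounded-map P⇒Q U Y with U Y
... | w , le , p = w , le , P⇒Q p

unbounded-image : ∀ {P Q : ℚ → Set} (φ : ℚ → ℚ) →
                  (∀ {w} → P w → w ≤ φ w × Q (φ w)) → Unbounded P → Unbounded Q
unbounded-image φ step U Y with U Y
... | w , le , p = φ w , ≤-trans le (proj₁ (step p)) , proj₂ (step p)

unbounded-shift : ∀ {P} c → Unbounded P → Unbounded (λ t → P (c + t))
unbounded-shift {P} c U Y with U (Y + c)
... | w , le , p = w - c , ≤-rearrange le (solve 3 (λ w c Y → (w :- c) :- Y := w :- (Y :+ c)) refl w c Y)
                 , subst P (sym (solve 2 (λ c w → c :+ (w :- c) := w) refl c w)) p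

eventually-excludes : ∀ {P Q} → Eventually P → Unbounded Q → (∀ {w} → P w → Q w → ⊥) → ⊥
eventually-excludes ev U incompatible with unbounded-∧ ev U 0ℚ
... | _ , _ , p , q = incompatible p q

slope-≤ : ∀ a a′ {b b′} → Unbounded (λ u → a + b * u ≤ a′ + b′ * u) → b ≤ b′
slope-≤ a a′ {b} {b′} U with b ≤? b′
... | yes b≤b′ = b≤b′
... | no b≰b′ = ⊥-elim (eventually-excludes (eventually-scaled 0<D (a′ - a + 1ℚ)) U gap)
  where
  D = b - b′
  0<D : 0ℚ < D
  0<D = ≤-<-trans (≤-reflexive (sym (+-inverseʳ b′))) (+-monoˡ-< (- b′) (≰⇒> b≰b′))
  gap : ∀ {u} → a′ - a + 1ℚ ≤ D * u → a + b * u ≤ a′ + b′ * u → ⊥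
  gap {u} big small = gap-absurd {D * u} {a′ - a}
    (≤-rearrange small (solve 5 (λ a b a′ b′ u → (a′ :- a) :- (b :- b′) :* u := (a′ :+ b′ :* u) :- (a :+ b :* u))
                                refl a b a′ b′ u))
    big

-- Univariate polynomials as coefficient lists a₀ ∷ a₁ ∷ …, evaluated by
-- Horner's rule, with the ring operations on lists.
evalC : List ℚ → ℚ → ℚ
evalC []      w = 0ℚ
evalC (a ∷ p) w = a + w * evalC p w

infixl 6 _+ᶜ_
infixl 7 _*ᶜ_

_+ᶜ_ : List ℚ → List ℚ → List ℚ
[]      +ᶜ q       = q
(a ∷ p) +ᶜ []      = a ∷ p
(a ∷ p) +ᶜ (b ∷ q) = (a + b) ∷ (p +ᶜ q)

scaleᶜ : ℚ → List ℚ → List ℚ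
scaleᶜ a []      = []
scaleᶜ a (b ∷ q) = a * b ∷ scaleᶜ a q

_*ᶜ_ : List ℚ → List ℚ → List ℚ
[]      *ᶜ q = []
(a ∷ p) *ᶜ q = scaleᶜ a q +ᶜ (0ℚ ∷ p *ᶜ q)

evalC-+ : ∀ p q w → evalC (p +ᶜ q) w ≡ evalC p w + evalC q w
evalC-+ []      q       w = sym (+-identityˡ _)
evalC-+ (a ∷ p) []      w = sym (+-identityʳ _)
evalC-+ (a ∷ p) (b ∷ q) w rewrite evalC-+ p q w =
  solve 5 (λ a b w x y → (a :+ b) :+ w :* (x :+ y) := (a :+ w :* x) :+ (b :+ w :* y))
        refl a b w (evalC p w) (evalC q w)

evalC-scale : ∀ a q w → evalC (scaleᶜ a q) w ≡ a * evalC q w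
evalC-scale a []      w = sym (*-zeroʳ a)
evalC-scale a (b ∷ q) w rewrite evalC-scale a q w =
  solve 4 (λ a b w x → a :* b :+ w :* (a :* x) := a :* (b :+ w :* x)) refl a b w (evalC q w)

evalC-* : ∀ p q w → evalC (p *ᶜ q) w ≡ evalC p w * evalC q w
evalC-* []      q w = sym (*-zeroˡ (evalC q w))
evalC-* (a ∷ p) q w
  rewrite evalC-+ (scaleᶜ a q) (0ℚ ∷ p *ᶜ q) w | evalC-scale a q w | evalC-* p q w =
  solve 4 (λ a w x y → a :* y :+ (con 0ℚ :+ w :* (x :* y)) := (a :+ w :* x) :* y)
        refl a w (evalC p w) (evalC q w)

evalP-cong : ∀ {A : Set} {_⊞_ _⊠_ : A → A → A} {n} (P : Poly A n) {ρ ρ′ : Fin n → A} →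
             (∀ i → ρ i ≡ ρ′ i) → evalP _⊞_ _⊠_ P ρ ≡ evalP _⊞_ _⊠_ P ρ′
evalP-cong                 (con a)  eq = refl
evalP-cong                 (pvar i) eq = eq i
evalP-cong {_⊞_ = _⊞_}     (P ⊕ Q)  eq = cong₂ _⊞_ (evalP-cong P eq) (evalP-cong Q eq)
evalP-cong {_⊠_ = _⊠_}     (P ⊗ Q)  eq = cong₂ _⊠_ (evalP-cong P eq) (evalP-cong Q eq)

substC : ∀ {n} → Poly ℚ n → (Fin n → List ℚ) → List ℚ
substC (con a)  σ = a ∷ []
substC (pvar i) σ = σ i
substC (P ⊕ Q)  σ = substC P σ +ᶜ substC Q σ
substC (P ⊗ Q)  σ = substC P σ *ᶜ substC Q σ

evalC-substC : ∀ {n} (P : Poly ℚ n) σ w →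
               evalC (substC P σ) w ≡ evalP _+_ _*_ P (λ i → evalC (σ i) w)
evalC-substC (con a)  σ w = trans (cong (a +_) (*-zeroʳ w)) (+-identityʳ a)
evalC-substC (pvar i) σ w = refl
evalC-substC (P ⊕ Q)  σ w =
  trans (evalC-+ (substC P σ) (substC Q σ) w) (cong₂ _+_ (evalC-substC P σ w) (evalC-substC Q σ w))
evalC-substC (P ⊗ Q)  σ w =
  trans (evalC-* (substC P σ) (substC Q σ) w) (cong₂ _*_ (evalC-substC P σ w) (evalC-substC Q σ w))

-- The constant and the linear coefficient.  Together they form a ring
-- homomorphism into the dual numbers a + bε (ε² = 0): the value and the
-- derivative at 0.
coeff₀ : List ℚ → ℚ
coeff₀ []      = 0ℚ
coeff₀ (a ∷ p) = a

coeff₁ : List ℚ → ℚ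
coeff₁ []      = 0ℚ
coeff₁ (a ∷ p) = coeff₀ p

coeff₀-+ : ∀ p q → coeff₀ (p +ᶜ q) ≡ coeff₀ p + coeff₀ q
coeff₀-+ []      q       = sym (+-identityˡ _)
coeff₀-+ (a ∷ p) []      = sym (+-identityʳ _)
coeff₀-+ (a ∷ p) (b ∷ q) = refl

coeff₁-+ : ∀ p q → coeff₁ (p +ᶜ q) ≡ coeff₁ p + coeff₁ q
coeff₁-+ []      q       = sym (+-identityˡ _)
coeff₁-+ (a ∷ p) []      = sym (+-identityʳ _)
coeff₁-+ (a ∷ p) (b ∷ q) = coeff₀-+ p q

coeff₀-scale : ∀ a q → coeff₀ (scaleᶜ a q) ≡ a * coeff₀ q
coeff₀-scale a []      = sym (*-zeroʳ a)
coeff₀-scale a (b ∷ q) = refl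

coeff₁-scale : ∀ a q → coeff₁ (scaleᶜ a q) ≡ a * coeff₁ q
coeff₁-scale a []      = sym (*-zeroʳ a)
coeff₁-scale a (b ∷ q) = coeff₀-scale a q

coeff₀-* : ∀ p q → coeff₀ (p *ᶜ q) ≡ coeff₀ p * coeff₀ q
coeff₀-* []      q = sym (*-zeroˡ (coeff₀ q))
coeff₀-* (a ∷ p) q =
  trans (coeff₀-+ (scaleᶜ a q) _) (trans (cong (_+ 0ℚ) (coeff₀-scale a q)) (+-identityʳ _))

coeff₁-* : ∀ p q → coeff₁ (p *ᶜ q) ≡ coeff₀ p * coeff₁ q + coeff₁ p * coeff₀ q
coeff₁-* []      q = solve 2 (λ x y → con 0ℚ := con 0ℚ :* x :+ con 0ℚ :* y) refl (coeff₁ q) (coeff₀ q)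
coeff₁-* (a ∷ p) q = begin
  coeff₁ (scaleᶜ a q +ᶜ (0ℚ ∷ p *ᶜ q))         ≡⟨ coeff₁-+ (scaleᶜ a q) (0ℚ ∷ p *ᶜ q) ⟩
  coeff₁ (scaleᶜ a q) + coeff₀ (p *ᶜ q)        ≡⟨ cong₂ _+_ (coeff₁-scale a q) (coeff₀-* p q) ⟩
  a * coeff₁ q + coeff₀ p * coeff₀ q           ∎
  where open ≡-Reasoning

record FirstOrderSplit (d a b : List ℚ) : Set where
  constructor splits
  field
    value₁ : coeff₀ d ≡ coeff₀ a
    value₂ : coeff₀ d ≡ coeff₀ b
    slope  : coeff₁ d ≡ coeff₁ a + coeff₁ b

split-+ : ∀ {d a b d′ a′ b′} → FirstOrderSplit d a b → FirstOrderSplit d′ a′ b′ →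
          FirstOrderSplit (d +ᶜ d′) (a +ᶜ a′) (b +ᶜ b′)
split-+ {d} {a} {b} {d′} {a′} {b′} (splits da db slope) (splits da′ db′ slope′) = splits
    (trans (coeff₀-+ d d′) (trans (cong₂ _+_ da da′) (sym (coeff₀-+ a a′))))
    (trans (coeff₀-+ d d′) (trans (cong₂ _+_ db db′) (sym (coeff₀-+ b b′))))
    (begin
      coeff₁ (d +ᶜ d′)                             ≡⟨ coeff₁-+ d d′ ⟩
      coeff₁ d + coeff₁ d′                         ≡⟨ cong₂ _+_ slope slope′ ⟩
      (coeff₁ a + coeff₁ b) + (coeff₁ a′ + coeff₁ b′)
        ≡⟨ solve 4 (λ x y x′ y′ → (x :+ y) :+ (x′ :+ y′) := (x :+ x′) :+ (y :+ y′))
                 refl (coeff₁ a) (coeff₁ b) (coeff₁ a′) (coeff₁ b′) ⟩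
      (coeff₁ a + coeff₁ a′) + (coeff₁ b + coeff₁ b′)
        ≡⟨ sym (cong₂ _+_ (coeff₁-+ a a′) (coeff₁-+ b b′)) ⟩
      coeff₁ (a +ᶜ a′) + coeff₁ (b +ᶜ b′)          ∎)
  where open ≡-Reasoning

split-* : ∀ {d a b d′ a′ b′} → FirstOrderSplit d a b → FirstOrderSplit d′ a′ b′ →
          FirstOrderSplit (d *ᶜ d′) (a *ᶜ a′) (b *ᶜ b′)
split-* {d} {a} {b} {d′} {a′} {b′} (splits da db slope) (splits da′ db′ slope′) = splits
    (trans (coeff₀-* d d′) (trans (cong₂ _*_ da da′) (sym (coeff₀-* a a′))))
    (trans (coeff₀-* d d′) (trans (cong₂ _*_ db db′) (sym (coeff₀-* b b′))))
    (begin
      coeff₁ (d *ᶜ d′)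
        ≡⟨ coeff₁-* d d′ ⟩
      coeff₀ d * coeff₁ d′ + coeff₁ d * coeff₀ d′
        ≡⟨ cong₂ _+_ (cong (coeff₀ d *_) slope′) (cong (_* coeff₀ d′) slope) ⟩
      coeff₀ d * (coeff₁ a′ + coeff₁ b′) + (coeff₁ a + coeff₁ b) * coeff₀ d′
        ≡⟨ solve 6 (λ v x y x′ y′ v′ → v :* (x′ :+ y′) :+ (x :+ y) :* v′
                                      := (v :* x′ :+ x :* v′) :+ (v :* y′ :+ y :* v′))
                 refl (coeff₀ d) (coeff₁ a) (coeff₁ b) (coeff₁ a′) (coeff₁ b′) (coeff₀ d′) ⟩
      (coeff₀ d * coeff₁ a′ + coeff₁ a * coeff₀ d′) + (coeff₀ d * coeff₁ b′ + coeff₁ b * coeff₀ d′)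
        ≡⟨ cong₂ _+_ (cong₂ (λ v v′ → v * coeff₁ a′ + coeff₁ a * v′) da da′)
                     (cong₂ (λ v v′ → v * coeff₁ b′ + coeff₁ b * v′) db db′) ⟩
      (coeff₀ a * coeff₁ a′ + coeff₁ a * coeff₀ a′) + (coeff₀ b * coeff₁ b′ + coeff₁ b * coeff₀ b′)
        ≡⟨ sym (cong₂ _+_ (coeff₁-* a a′) (coeff₁-* b b′)) ⟩
      coeff₁ (a *ᶜ a′) + coeff₁ (b *ᶜ b′)
        ∎)
  where open ≡-Reasoning

-- Substitution preserves first-order splittings (the chain rule).
split-substC : ∀ {n} {σ σ₁ σ₂ : Fin n → List ℚ} → (∀ i → FirstOrderSplit (σ i) (σ₁ i) (σ₂ i)) →
               ∀ P → FirstOrderSplit (substC P σ) (substC P σ₁) (substC P σ₂)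
split-substC split (con a)  = splits refl refl (sym (+-identityˡ 0ℚ))
split-substC split (pvar i) = split i
split-substC split (P ⊕ Q)  = split-+ (split-substC split P) (split-substC split Q)
split-substC split (P ⊗ Q)  = split-* (split-substC split P) (split-substC split Q)

-- The substitutions moving (x, y) from (c, c) to (c+t, c+t), (c+t, c)
-- and (c, c+t) respectively.
moveBoth moveFirst moveSecond : ℚ → Fin 2 → List ℚ
moveBoth   c _           = c ∷ 1ℚ ∷ []
moveFirst  c Fin.zero    = c ∷ 1ℚ ∷ []
moveFirst  c (Fin.suc _) = c ∷ []
moveSecond c Fin.zero    = c ∷ []
moveSecond c (Fin.suc _) = c ∷ 1ℚ ∷ []

diagonal-split : ∀ (P : Poly ℚ 2) c →
  FirstOrderSplit (substC P (moveBoth c)) (substC P (moveFirst c)) (substC P (moveSecond c))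
diagonal-split P c = split-substC variables P
  where
  variables : ∀ i → FirstOrderSplit (moveBoth c i) (moveFirst c i) (moveSecond c i)
  variables Fin.zero    = splits refl refl (sym (+-identityʳ 1ℚ))
  variables (Fin.suc _) = splits refl refl (sym (+-identityˡ 1ℚ))

-- Zero test, degree and leading coefficient of a coefficient list
-- (trailing zero coefficients are ignored).
isZero : List ℚ → Bool
isZero []      = true
isZero (a ∷ p) = does (a ≟ 0ℚ) ∧ isZero p

deg : List ℚ → ℕ
deg []      = 0
deg (a ∷ p) = if isZero p then 0 else suc (deg p)

lead : List ℚ → ℚ
lead []      = 0ℚ
lead (a ∷ p) = if isZero p then a else lead p

isZero-eval : ∀ p → isZero p ≡ true → ∀ w → evalC p w ≡ 0ℚ
isZero-eval []      _ w = refl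
isZero-eval (a ∷ p) z w with a ≟ 0ℚ | isZero p in p-zero
... | yes refl | true = trans (+-identityˡ _) (trans (cong (w *_) (isZero-eval p p-zero w)) (*-zeroʳ w))

isZero-coeff₀ : ∀ p → isZero p ≡ true → coeff₀ p ≡ 0ℚ
isZero-coeff₀ []      _ = refl
isZero-coeff₀ (a ∷ p) z with a ≟ 0ℚ
... | yes a≡0 = a≡0

lead≢0 : ∀ p → isZero p ≡ false → lead p ≢ 0ℚ
lead≢0 (a ∷ p) nz with isZero p in p-zero
... | false = lead≢0 p p-zero
... | true with a ≟ 0ℚ
...   | no a≢0 = a≢0

1≤deg⇒nonzero : ∀ p → 1 N.≤ deg p → isZero p ≡ false
1≤deg⇒nonzero (a ∷ p) 1≤d with isZero p
... | false = ∧-zeroʳ (does (a ≟ 0ℚ))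

constant-eval : ∀ p → deg p ≡ 0 → ∀ w → evalC p w ≡ coeff₀ p
constant-eval []      _ w = refl
constant-eval (a ∷ p) d≡0 w with isZero p in p-zero
... | true = trans (cong (a +_) (trans (cong (w *_) (isZero-eval p p-zero w)) (*-zeroʳ w))) (+-identityʳ a)

affine-eval : ∀ p → deg p N.≤ 1 → ∀ w → evalC p w ≡ coeff₀ p + coeff₁ p * w
affine-eval []      _ w = solve 1 (λ w → con 0ℚ := con 0ℚ :+ con 0ℚ :* w) refl w
affine-eval (a ∷ p) d≤1 w with isZero p in p-zero
... | true rewrite isZero-eval p p-zero w | isZero-coeff₀ p p-zero =
  solve 2 (λ a w → a :+ w :* con 0ℚ := a :+ con 0ℚ :* w) refl a w
affine-eval (a ∷ p) (N.s≤s d≤0) w | false rewrite constant-eval p (NP.n≤0⇒n≡0 d≤0) w =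
  solve 3 (λ a w b → a :+ w :* b := a :+ b :* w) refl a w (coeff₀ p)

-- By induction on
-- p = a + w·q: for constant q the bounds are exact, otherwise the
-- bounds for q at ε/2 are multiplied by w and |a| is absorbed.
LeadingBounds : List ℚ → ℚ → ℚ → Set
LeadingBounds p ε w =
  1ℚ ≤ w × (lead p - ε) * w ^ deg p ≤ evalC p w × evalC p w ≤ (lead p + ε) * w ^ deg p

leading-term : ∀ p → isZero p ≡ false → ∀ {ε} → 0ℚ < ε → Eventually (LeadingBounds p ε)
leading-term (a ∷ q) nz {ε} 0<ε with isZero q in q-zero
... | true = 1ℚ , λ w 1≤w → 1≤w , lower w , upper w
  where
  constant : ∀ w → a + w * evalC q w ≡ a
  constant w = trans (cong (λ z → a + w * z) (isZero-eval q q-zero w))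
                     (trans (cong (a +_) (*-zeroʳ w)) (+-identityʳ a))
  lower : ∀ w → (a - ε) * 1ℚ ≤ a + w * evalC q w
  lower w rewrite constant w =
    ≤-rearrange (<⇒≤ 0<ε) (solve 2 (λ a e → a :- (a :- e) :* con 1ℚ := e :- con 0ℚ) refl a ε)
  upper : ∀ w → a + w * evalC q w ≤ (a + ε) * 1ℚ
  upper w rewrite constant w =
    ≤-rearrange (<⇒≤ 0<ε) (solve 2 (λ a e → (a :+ e) :* con 1ℚ :- a := e :- con 0ℚ) refl a ε)
... | false = eventually-map bounds
                (eventually-∧ (leading-term q q-zero ε′-pos) (eventually-scaled ε′-pos (a ⊔ - a)))
  where
  ε′ = ε * ½
  ε′-pos = half-pos 0<ε
  -- |a| ≤ ε′ w ≤ ε′ w^(deg q + 1).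
  bounds : ∀ {w} → LeadingBounds q ε′ w × a ⊔ - a ≤ ε′ * w →
             1ℚ ≤ w
           × (lead q - ε) * (w * w ^ deg q) ≤ a + w * evalC q w
           × a + w * evalC q w ≤ (lead q + ε) * (w * w ^ deg q)
  bounds {w} ((1≤w , lo , hi) , a-small) = 1≤w , lower , upper
    where
    0≤w = ≤-trans (<⇒≤ 0<1) 1≤w
    P = w ^ deg q
    small : a ⊔ - a ≤ ε′ * (w * P)
    small = ≤-trans a-small (*-monoˡ-≤ (<⇒≤ ε′-pos)
              (≤-trans (≤-reflexive (sym (*-identityʳ w))) (*-monoˡ-≤ 0≤w (1≤^ (deg q) 1≤w))))
    lower : (lead q - ε) * (w * P) ≤ a + w * evalC q w
    lower = ≤-rearrange (+-mono-≤ (≤-trans (p≤q⊔p a (- a)) small) (*-monoˡ-≤ 0≤w lo))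
      (solve 6 (λ a w P l e E → (a :+ w :* E) :- (l :- e) :* (w :* P)
                              := (e :* con ½ :* (w :* P) :+ w :* E) :- (:- a :+ w :* ((l :- e :* con ½) :* P)))
             refl a w P (lead q) ε (evalC q w))
    upper : a + w * evalC q w ≤ (lead q + ε) * (w * P)
    upper = ≤-rearrange (+-mono-≤ (≤-trans (p≤p⊔q a (- a)) small) (*-monoˡ-≤ 0≤w hi))
      (solve 6 (λ a w P l e E → (l :+ e) :* (w :* P) :- (a :+ w :* E)
                              := (e :* con ½ :* (w :* P) :+ w :* ((l :+ e :* con ½) :* P)) :- (a :+ w :* E))
             refl a w P (lead q) ε (evalC q w))

record PolyFn (Q : ℚ → ℚ) (p : List ℚ) : Set where
  constructor polyFn
  field evalsTo : ∀ w → Q w ≡ evalC p w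
open PolyFn public

unaryᶜ : Poly ℚ 1 → List ℚ
unaryᶜ P = substC P (λ _ → 0ℚ ∷ 1ℚ ∷ [])

unary-polyFn : ∀ P → PolyFn (λ w → evalP _+_ _*_ P (λ _ → w)) (unaryᶜ P)
unary-polyFn P = polyFn λ w → sym (trans (evalC-substC P _ w) (evalP-cong {_⊞_ = _+_} {_*_} P (λ _ → identity w)))
  where
  identity : ∀ w → evalC (0ℚ ∷ 1ℚ ∷ []) w ≡ w
  identity w = solve 1 (λ w → con 0ℚ :+ w :* (con 1ℚ :+ w :* con 0ℚ) := w) refl w

lead-pos : ∀ {Q p} → PolyFn Q p → isZero p ≡ false → Unbounded (λ w → 0ℚ ≤ Q w) → 0ℚ < lead p
lead-pos {Q} {p} Q≡p nz U with <-cmp 0ℚ (lead p)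
... | tri< 0<l _ _ = 0<l
... | tri≈ _ 0≡l _ = ⊥-elim (lead≢0 p nz (sym 0≡l))
... | tri> _ _ l<0 = ⊥-elim (eventually-excludes (leading-term p nz 0<ε) U eventually-negative)
  where
  l = lead p
  ε = (- l) * ½
  0<ε = half-pos (neg-antimono-< l<0)
  -- Eventually Q w ≤ (l + ε) w^deg = -(ε w^deg) < 0.
  eventually-negative : ∀ {w} → LeadingBounds p ε w → 0ℚ ≤ Q w → ⊥
  eventually-negative {w} (1≤w , _ , hi) 0≤Q = <-irrefl refl (<-≤-trans 0<εP (begin
    ε * P             ≡⟨ solve 2 (λ l P → (:- l :* con ½) :* P := :- ((l :+ :- l :* con ½) :* P)) refl l P ⟩
    - ((l + ε) * P)   ≤⟨ neg-antimono-≤ (≤-trans 0≤Q (≤-trans (≤-reflexive (evalsTo Q≡p w)) hi)) ⟩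
    0ℚ                ∎))
    where
    open ≤-Reasoning
    P = w ^ deg p
    0<εP = *-pos 0<ε (^-pos (deg p) (<-≤-trans 0<1 1≤w))

Superlinear : (ℚ → ℚ) → Set
Superlinear Q = ∀ M → Eventually (λ w → M * w ≤ Q w)

superlinear : ∀ {Q p} → PolyFn Q p → 2 N.≤ deg p → 0ℚ < lead p → Superlinear Q
superlinear {Q} {p} Q≡p 2≤d 0<l M =
  eventually-map bound (eventually-∧ (leading-term p nz 0<l′) (eventually-scaled 0<l′ M))
  where
  nz = 1≤deg⇒nonzero p (NP.≤-trans (N.s≤s N.z≤n) 2≤d)
  l′ = lead p * ½
  0<l′ = half-pos 0<l
  bound : ∀ {w} → LeadingBounds p l′ w × M ≤ l′ * w → M * w ≤ Q w
  bound {w} ((1≤w , lo , _) , M≤l′w) = begin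
    M * w                   ≤⟨ *-monoʳ-≤ 0≤w M≤l′w ⟩
    l′ * w * w              ≡⟨ solve 2 (λ l w → l :* w :* w := l :* (w :* (w :* con 1ℚ))) refl l′ w ⟩
    l′ * w ^ 2              ≤⟨ *-monoˡ-≤ (<⇒≤ 0<l′) (^-monoʳ 1≤w 2≤d) ⟩
    l′ * w ^ deg p          ≡⟨ cong (_* w ^ deg p) (solve 1 (λ l → l :* con ½ := l :- l :* con ½) refl (lead p)) ⟩
    (lead p - l′) * w ^ deg p ≤⟨ lo ⟩
    evalC p w               ≡⟨ sym (evalsTo Q≡p w) ⟩
    Q w                     ∎
    where
    open ≤-Reasoning
    0≤w = ≤-trans (<⇒≤ 0<1) 1≤w

superlinear-unbounded : ∀ {Q a b} → Superlinear Q → Unbounded (λ w → Q w ≤ a + b * w) → ⊥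
superlinear-unbounded {Q} {a} {b} sl U =
  eventually-excludes (eventually-∧ (sl (b + 1ℚ)) (eventually-≥ (a + 1ℚ))) U absurd
  where
  absurd : ∀ {w} → (b + 1ℚ) * w ≤ Q w × a + 1ℚ ≤ w → Q w ≤ a + b * w → ⊥
  absurd {w} (big , a+1≤w) small = gap-absurd {w} {a}
    (≤-rearrange (≤-trans big small) (solve 3 (λ a b w → a :- w := (a :+ b :* w) :- (b :+ con 1ℚ) :* w) refl a b w))
    a+1≤w

affinely-bounded : ∀ {Q p} a b → PolyFn Q p → Unbounded (λ w → 0ℚ ≤ Q w) →
                   Unbounded (λ w → Q w ≤ a + b * w) → deg p N.≤ 1 × coeff₁ p ≤ b
affinely-bounded {Q} {p} a b Q≡p nonNeg bounded = affine , slope-≤ (coeff₀ p) a (unbounded-map as-affine bounded)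
  where
  affine : deg p N.≤ 1
  affine with deg p N.≤? 1
  ... | yes d≤1 = d≤1
  ... | no d≰1 = ⊥-elim (superlinear-unbounded {Q} {a} {b}
                    (superlinear {Q} {p} Q≡p 2≤d (lead-pos {Q} {p} Q≡p nz nonNeg)) bounded)
    where
    2≤d = NP.≰⇒> d≰1
    nz = 1≤deg⇒nonzero p (NP.≤-trans (N.s≤s N.z≤n) 2≤d)
  as-affine : ∀ {w} → Q w ≤ a + b * w → coeff₀ p + coeff₁ p * w ≤ a + b * w
  as-affine {w} = ≤-trans (≤-reflexive (sym (trans (evalsTo Q≡p w) (affine-eval p affine w))))

record PowerGrowth (Q : ℚ → ℚ) (d : ℕ) : Set where
  field
    lo hi     : ℚ
    lo-pos    : 0ℚ < lo
    hi-nonNeg : 0ℚ ≤ hi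
    bounds    : Eventually (λ w → 1ℚ ≤ w × lo * w ^ d ≤ Q w × Q w ≤ hi * w ^ d)

power-growth : ∀ {Q p} → PolyFn Q p → isZero p ≡ false → 0ℚ < lead p → PowerGrowth Q (deg p)
power-growth {Q} {p} Q≡p nz 0<l = record
  { lo = l - l * ½ ; hi = l + l * ½
  ; lo-pos = <-≤-trans (half-pos 0<l) (≤-reflexive (solve 1 (λ l → l :* con ½ := l :- l :* con ½) refl l))
  ; hi-nonNeg = +-nonNeg (<⇒≤ 0<l) (<⇒≤ (half-pos 0<l))
  ; bounds = eventually-map (λ {w} (1≤w , lo , hi) → 1≤w , ≤-trans lo (≤-reflexive (sym (evalsTo Q≡p w)))
                                                          , ≤-trans (≤-reflexive (evalsTo Q≡p w)) hi)
                            (leading-term p nz (half-pos 0<l)) }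
  where l = lead p

power-gap : ∀ {κ K a b} → 0ℚ < κ → b N.< a → Unbounded (λ u → κ * u ^ a ≤ K * u ^ b) → ⊥
power-gap {κ} {K} {a} {b} 0<κ b<a U =
  eventually-excludes (eventually-∧ (eventually-≥ 1ℚ) (eventually-scaled 0<κ (K + 1ℚ))) U absurd
  where
  absurd : ∀ {u} → 1ℚ ≤ u × K + 1ℚ ≤ κ * u → κ * u ^ a ≤ K * u ^ b → ⊥
  absurd {u} (1≤u , big) small = gap-absurd {κ * u} {K} (*-cancelʳ-≤-pos (u ^ b) {{positive 0<uᵇ}} (begin
    κ * u * u ^ b    ≡⟨ *-assoc κ u (u ^ b) ⟩
    κ * u ^ suc b    ≤⟨ *-monoˡ-≤ (<⇒≤ 0<κ) (^-monoʳ 1≤u b<a) ⟩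
    κ * u ^ a        ≤⟨ small ⟩
    K * u ^ b        ∎)) big
    where
    open ≤-Reasoning
    0<uᵇ = ^-pos b (<-≤-trans 0<1 1≤u)

ι : ℤ → ℚ
ι z = z / 1

ι-unnormalised : ∀ z → toℚᵘ (ι z) U.≃ U.mkℚᵘ z 0
ι-unnormalised z = toℚᵘ-fromℚᵘ (U.mkℚᵘ z 0)

ι-+ : ∀ a b → ι (a Z.+ b) ≡ ι a + ι b
ι-+ a b = toℚᵘ-injective (UP.≃-trans (ι-unnormalised (a Z.+ b)) (UP.≃-trans (U.*≡* eq)
  (UP.≃-sym (UP.≃-trans (toℚᵘ-homo-+ (ι a) (ι b)) (UP.+-cong (ι-unnormalised a) (ι-unnormalised b))))))
  where
  eq : (a Z.+ b) Z.* Z.+ 1 ≡ (a Z.* Z.+ 1 Z.+ b Z.* Z.+ 1) Z.* Z.+ 1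
  eq = trans (ZP.*-identityʳ (a Z.+ b))
             (sym (trans (ZP.*-identityʳ _) (cong₂ Z._+_ (ZP.*-identityʳ a) (ZP.*-identityʳ b))))

ι-* : ∀ a b → ι (a Z.* b) ≡ ι a * ι b
ι-* a b = toℚᵘ-injective (UP.≃-trans (ι-unnormalised (a Z.* b)) (UP.≃-trans (U.*≡* refl)
  (UP.≃-sym (UP.≃-trans (toℚᵘ-homo-* (ι a) (ι b)) (UP.*-cong (ι-unnormalised a) (ι-unnormalised b))))))

ι-mono : ∀ {a b} → a Z.≤ b → ι a ≤ ι b
ι-mono {a} {b} a≤b = toℚᵘ-cancel-≤ (UP.≤-respˡ-≃ (UP.≃-sym (ι-unnormalised a))
  (UP.≤-respʳ-≃ (UP.≃-sym (ι-unnormalised b)) (U.*≤* (ZP.*-monoʳ-≤-nonNeg (Z.+ 1) a≤b))))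

ι-cancel : ∀ {a b} → ι a ≤ ι b → a Z.≤ b
ι-cancel {a} {b} ιa≤ιb
  with UP.≤-respˡ-≃ (ι-unnormalised a) (UP.≤-respʳ-≃ (ι-unnormalised b) (toℚᵘ-mono-≤ ιa≤ιb))
... | U.*≤* le = ZP.≤-trans (ZP.≤-reflexive (sym (ZP.*-identityʳ a)))
                   (ZP.≤-trans le (ZP.≤-reflexive (ZP.*-identityʳ b)))

archimedean : ∀ q → Σ ℕ λ k → q ≤ ι (Z.+ k)
archimedean (mkℚ n d-1 _) = Z.∣ n ∣ ,
  toℚᵘ-cancel-≤ (UP.≤-respʳ-≃ (UP.≃-sym (ι-unnormalised (Z.+ Z.∣ n ∣))) (U.*≤* (begin
    n Z.* Z.+ 1                 ≡⟨ ZP.*-identityʳ n ⟩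
    n                         ≤⟨ below-abs n ⟩
    Z.+ Z.∣ n ∣                 ≡⟨ sym (ZP.*-identityʳ (Z.+ Z.∣ n ∣)) ⟩
    Z.+ Z.∣ n ∣ Z.* Z.+ 1         ≤⟨ ZP.*-monoˡ-≤-nonNeg (Z.+ Z.∣ n ∣) (Z.+≤+ (N.s≤s N.z≤n)) ⟩
    Z.+ Z.∣ n ∣ Z.* Z.+ suc d-1   ∎)))
  where
  open ZP.≤-Reasoning
  below-abs : ∀ i → i Z.≤ Z.+ Z.∣ i ∣
  below-abs (Z.+ m)     = ZP.≤-refl
  below-abs Z.-[1+ m ] = Z.-≤+

module Grid {δ : ℚ} (0<δ : 0ℚ < δ) where

  gridPoint : ℕ → ℚ
  gridPoint n = δ * ι (Z.+ n)

  gridPoint-zero : gridPoint 0 ≡ 0ℚ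
  gridPoint-zero = *-zeroʳ δ

  gridPoint-suc : ∀ n → gridPoint (suc n) ≡ gridPoint n + δ
  gridPoint-suc n = begin
    δ * ι (Z.+ suc n)             ≡⟨ cong (λ m → δ * ι (Z.+ m)) (NP.+-comm 1 n) ⟩
    δ * ι (Z.+ n Z.+ Z.+ 1)         ≡⟨ cong (δ *_) (ι-+ (Z.+ n) (Z.+ 1)) ⟩
    δ * (ι (Z.+ n) + 1ℚ)          ≡⟨ solve 2 (λ d x → d :* (x :+ con 1ℚ) := d :* x :+ d) refl δ (ι (Z.+ n)) ⟩
    δ * ι (Z.+ n) + δ             ∎
    where open ≡-Reasoning

  OnGrid : ℚ → Set
  OnGrid w = Σ ℕ λ n → w ≡ gridPoint n

  grid-unbounded : Unbounded OnGrid
  grid-unbounded Y with archimedean (_÷_ Y δ {{pos⇒nonZero δ {{positive 0<δ}}}})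
  ... | k , le = gridPoint k , ÷-bound 0<δ le , k , refl

-- Self-maps of a set Dom ⊆ ℚ₀ containing the grid δℕ that increase by at
-- least δ whenever their argument does (the strict order of a polynomial
-- interpretation over ℚ, and over ℕ with δ = 1).
module DeltaMonotone {δ : ℚ} (0<δ : 0ℚ < δ) (Dom : ℚ → Set)
  (Dom-nonNeg : ∀ {w} → Dom w → 0ℚ ≤ w) (grid⊆Dom : ∀ n → Dom (Grid.gridPoint 0<δ n)) where

  open Grid 0<δ public

  _≻_ : ℚ → ℚ → Set
  y ≻ z = δ ≤ y - z

  record DeltaMap (Q : ℚ → ℚ) : Set where
    field
      closed : ∀ y → Dom y → Dom (Q y)
      mono   : MonoUnary Dom _≻_ Q

  onGrid-Dom : ∀ {w} → OnGrid w → Dom w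
  onGrid-Dom (n , refl) = grid⊆Dom n

  delta-step : ∀ Q → MonoUnary Dom _≻_ Q → ∀ {y z} → Dom y → Dom z → z + δ ≤ y → Q z + δ ≤ Q y
  delta-step Q mono {y} {z} dy dz z+δ≤y =
    ≤-rearrange (mono y z dy dz (≤-rearrange z+δ≤y (solve 3 (λ y z d → (y :- z) :- d := y :- (z :+ d)) refl y z δ)))
                (solve 3 (λ a b d → a :- (b :+ d) := (a :- b) :- d) refl (Q y) (Q z) δ)

  grid-increasing : ∀ {Q} → DeltaMap Q → ∀ {w} → OnGrid w → w ≤ Q w
  grid-increasing {Q} δQ (n , refl) = at n
    where
    open DeltaMap δQ
    at : ∀ n → gridPoint n ≤ Q (gridPoint n)
    at zero    = ≤-trans (≤-reflexive gridPoint-zero) (Dom-nonNeg (closed _ (grid⊆Dom 0)))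
    at (suc n) = begin
      gridPoint (suc n)       ≡⟨ gridPoint-suc n ⟩
      gridPoint n + δ         ≤⟨ +-monoˡ-≤ δ (at n) ⟩
      Q (gridPoint n) + δ     ≤⟨ delta-step Q mono (grid⊆Dom (suc n)) (grid⊆Dom n) (≤-reflexive (sym (gridPoint-suc n))) ⟩
      Q (gridPoint (suc n))   ∎
      where open ≤-Reasoning

  diagonal-increasing : ∀ (H : ℚ → ℚ → ℚ) → (∀ y z → Dom y → Dom z → Dom (H y z)) →
    (∀ z → Dom z → MonoUnary Dom _≻_ (λ y → H y z)) → (∀ z → Dom z → MonoUnary Dom _≻_ (λ y → H z y)) →
    ∀ {w} → OnGrid w → w + w ≤ H w w
  diagonal-increasing H closed mono₁ mono₂ (n , refl) = at n
    where
    at : ∀ n → gridPoint n + gridPoint n ≤ H (gridPoint n) (gridPoint n)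
    at zero = ≤-trans (≤-reflexive (cong₂ _+_ gridPoint-zero gridPoint-zero))
                      (Dom-nonNeg (closed _ _ (grid⊆Dom 0) (grid⊆Dom 0)))
    at (suc n) = begin
      p′ + p′                 ≡⟨ cong₂ _+_ (gridPoint-suc n) (gridPoint-suc n) ⟩
      (p + δ) + (p + δ)       ≡⟨ solve 2 (λ p d → (p :+ d) :+ (p :+ d) := ((p :+ p) :+ d) :+ d) refl p δ ⟩
      ((p + p) + δ) + δ       ≤⟨ +-monoˡ-≤ δ (+-monoˡ-≤ δ (at n)) ⟩
      (H p p + δ) + δ         ≤⟨ +-monoˡ-≤ δ (delta-step (H p) (mono₂ p (grid⊆Dom n)) (grid⊆Dom (suc n)) (grid⊆Dom n) step) ⟩
      H p p′ + δ              ≤⟨ delta-step (λ y → H y p′) (mono₁ p′ (grid⊆Dom (suc n))) (grid⊆Dom (suc n)) (grid⊆Dom n) step ⟩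
      H p′ p′                 ∎
      where
      open ≤-Reasoning
      p = gridPoint n
      p′ = gridPoint (suc n)
      step = ≤-reflexive (sym (gridPoint-suc n))

  grid-nonNeg : ∀ {Q} → DeltaMap Q → Unbounded (λ w → 0ℚ ≤ Q w)
  grid-nonNeg δQ = unbounded-map (λ on → Dom-nonNeg (DeltaMap.closed δQ _ (onGrid-Dom on))) grid-unbounded

  grid-rise : ∀ {Q} → DeltaMap Q → δ ≤ Q (gridPoint 1) - Q (gridPoint 0)
  grid-rise δQ = DeltaMap.mono δQ _ _ (grid⊆Dom 1) (grid⊆Dom 0)
    (≤-rearrange (≤-refl {δ}) (trans (cong (λ q → q - gridPoint 0 - δ) (gridPoint-suc 0))
      (solve 2 (λ p d → (p :+ d) :- p :- d := d :- d) refl (gridPoint 0) δ)))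

  nonconstant : ∀ {Q p} → DeltaMap Q → PolyFn Q p → 1 N.≤ deg p
  nonconstant {Q} {p} δQ Q≡p with deg p in deg≡
  ... | suc _ = N.s≤s N.z≤n
  ... | zero = ⊥-elim (<-irrefl refl (<-≤-trans 0<δ (≤-trans (grid-rise δQ) (≤-reflexive flat))))
    where
    flat : Q (gridPoint 1) - Q (gridPoint 0) ≡ 0ℚ
    flat = trans (cong₂ _-_ (trans (evalsTo Q≡p _) (constant-eval p deg≡ _)) (trans (evalsTo Q≡p _) (constant-eval p deg≡ _)))
                 (+-inverseʳ (coeff₀ p))

  slope≥1 : ∀ {Q} a b → DeltaMap Q → (∀ w → Q w ≡ a + b * w) → 1ℚ ≤ b
  slope≥1 {Q} a b δQ Q≡ = *-cancelʳ-≤-pos δ {{positive 0<δ}} (begin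
    1ℚ * δ                                 ≡⟨ *-identityˡ δ ⟩
    δ                                      ≤⟨ grid-rise δQ ⟩
    Q (gridPoint 1) - Q (gridPoint 0)      ≡⟨ cong₂ _-_ (trans (Q≡ _) (cong (λ x → a + b * x) (gridPoint-suc 0))) (Q≡ _) ⟩
    (a + b * (gridPoint 0 + δ)) - (a + b * gridPoint 0)
      ≡⟨ solve 4 (λ a b p d → (a :+ b :* (p :+ d)) :- (a :+ b :* p) := b :* d) refl a b (gridPoint 0) δ ⟩
    b * δ                                  ∎)
    where open ≤-Reasoning

  module Composites {F G pF pG} (δF : DeltaMap F) (δG : DeltaMap G)
    (F≡ : PolyFn F pF) (G≡ : PolyFn G pG) (2≤d : 2 N.≤ deg pG) where

    d e : ℕ
    d = deg pG
    e = deg pF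

    1≤e : 1 N.≤ e
    1≤e = nonconstant δF F≡

    nzG : isZero pG ≡ false
    nzG = 1≤deg⇒nonzero pG (NP.≤-trans (N.s≤s N.z≤n) 2≤d)

    nzF : isZero pF ≡ false
    nzF = 1≤deg⇒nonzero pF 1≤e

    0<lead-G : 0ℚ < lead pG
    0<lead-G = lead-pos G≡ nzG (grid-nonNeg δG)

    module ΓG = PowerGrowth (power-growth G≡ nzG 0<lead-G)
    module ΓF = PowerGrowth (power-growth F≡ nzF (lead-pos F≡ nzF (grid-nonNeg δF)))

    κ K : ℚ
    κ = ΓG.lo * (ΓG.lo * ΓF.lo ^ d) ^ d
    K = ΓF.hi * ΓG.hi ^ e

    0<κ : 0ℚ < κ
    0<κ = *-pos ΓG.lo-pos (^-pos d (*-pos ΓG.lo-pos (^-pos d ΓF.lo-pos)))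

    exponents : d N.* e N.< e N.* d N.* d
    exponents = subst (N._< e N.* d N.* d) (NP.*-comm e d) (NP.m<m*n (e N.* d) d {{ed≢0}} 2≤d)
      where
      ed≢0 : N.NonZero (e N.* d)
      ed≢0 = NP.m*n≢0 e d {{N.>-nonZero 1≤e}} {{N.>-nonZero (NP.≤-trans (N.s≤s N.z≤n) 2≤d)}}

    record Large (w : ℚ) : Set where
      field
        one≤ : 1ℚ ≤ w
        G-lo : ΓG.lo * w ^ d ≤ G w
        G-hi : G w ≤ ΓG.hi * w ^ d
        F-lo : ΓF.lo * w ^ e ≤ F w
        F-hi : F w ≤ ΓF.hi * w ^ e
        G-id : w ≤ G w

    large : Eventually Large
    large = eventually-map
      (λ {w} (((1≤w , G-lo , G-hi) , (_ , F-lo , F-hi)) , G-sl) →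
         record { one≤ = 1≤w ; G-lo = G-lo ; G-hi = G-hi ; F-lo = F-lo ; F-hi = F-hi
                ; G-id = ≤-trans (≤-reflexive (sym (*-identityˡ w))) G-sl })
      (eventually-∧ (eventually-∧ ΓG.bounds ΓF.bounds) (superlinear G≡ 2≤d 0<lead-G 1ℚ))

    Y : ℚ
    Y = proj₁ large

    at : ∀ w → Y ≤ w → Large w
    at = proj₂ large

    open Large

    lower : ∀ {u} → Y ≤ u → OnGrid u → κ * u ^ (e N.* d N.* d) ≤ G (G (F u))
    lower {u} Y≤u on = begin
      κ * u ^ (e N.* d N.* d)                        ≡⟨ collect ⟩
      ΓG.lo * (ΓG.lo * (ΓF.lo * u ^ e) ^ d) ^ d       ≤⟨ raise (*-nonNeg 0≤lo-G (^-nonNeg d 0≤Fu-lo))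
                                                          (raise 0≤Fu-lo (F-lo (at u Y≤u))) ⟩
      ΓG.lo * (ΓG.lo * v ^ d) ^ d                     ≤⟨ raise (*-nonNeg 0≤lo-G (^-nonNeg d 0≤v))
                                                          (G-lo (at v Y≤v)) ⟩
      ΓG.lo * G v ^ d                                 ≤⟨ G-lo (at (G v) (≤-trans Y≤v (G-id (at v Y≤v)))) ⟩
      G (G v)                                         ∎
      where
      open ≤-Reasoning
      v = F u
      0≤u = ≤-trans (<⇒≤ 0<1) (one≤ (at u Y≤u))
      Y≤v = ≤-trans Y≤u (grid-increasing δF on)
      0≤v = ≤-trans 0≤u (grid-increasing δF on)
      0≤lo-G = <⇒≤ ΓG.lo-pos
      0≤Fu-lo = *-nonNeg (<⇒≤ ΓF.lo-pos) (^-nonNeg e 0≤u)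
      raise : ∀ {a b} → 0ℚ ≤ a → a ≤ b → ΓG.lo * a ^ d ≤ ΓG.lo * b ^ d
      raise 0≤a a≤b = *-monoˡ-≤ 0≤lo-G (^-monoˡ d 0≤a a≤b)
      collect : κ * u ^ (e N.* d N.* d) ≡ ΓG.lo * (ΓG.lo * (ΓF.lo * u ^ e) ^ d) ^ d
      collect = sym (begin-equality
        ΓG.lo * (ΓG.lo * (ΓF.lo * u ^ e) ^ d) ^ d         ≡⟨ cong (λ z → ΓG.lo * (ΓG.lo * z) ^ d) (scaled-power ΓF.lo u e d) ⟩
        ΓG.lo * (ΓG.lo * (ΓF.lo ^ d * u ^ (e N.* d))) ^ d  ≡⟨ cong (λ z → ΓG.lo * z ^ d) (sym (*-assoc ΓG.lo (ΓF.lo ^ d) _)) ⟩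
        ΓG.lo * (ΓG.lo * ΓF.lo ^ d * u ^ (e N.* d)) ^ d    ≡⟨ cong (ΓG.lo *_) (scaled-power (ΓG.lo * ΓF.lo ^ d) u (e N.* d) d) ⟩
        ΓG.lo * ((ΓG.lo * ΓF.lo ^ d) ^ d * u ^ (e N.* d N.* d)) ≡⟨ sym (*-assoc ΓG.lo _ _) ⟩
        κ * u ^ (e N.* d N.* d)                             ∎)

    upper : ∀ {u} → Y ≤ u → OnGrid u → F (G u) ≤ K * u ^ (d N.* e)
    upper {u} Y≤u on = begin
      F (G u)                      ≤⟨ F-hi (at (G u) Y≤Gu) ⟩
      ΓF.hi * G u ^ e              ≤⟨ *-monoˡ-≤ ΓF.hi-nonNeg (^-monoˡ e 0≤Gu (G-hi (at u Y≤u))) ⟩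
      ΓF.hi * (ΓG.hi * u ^ d) ^ e  ≡⟨ cong (ΓF.hi *_) (scaled-power ΓG.hi u d e) ⟩
      ΓF.hi * (ΓG.hi ^ e * u ^ (d N.* e)) ≡⟨ sym (*-assoc ΓF.hi _ _) ⟩
      K * u ^ (d N.* e)            ∎
      where
      open ≤-Reasoning
      Y≤Gu = ≤-trans Y≤u (grid-increasing δG on)
      0≤Gu = ≤-trans (≤-trans (<⇒≤ 0<1) (one≤ (at u Y≤u))) (grid-increasing δG on)

  -- The rule f(g(x)) → g(g(f(x))) forces g to be affine: if
  -- G(G(F w)) ≤ F(G w) along the grid and deg G ≥ 2, the power w^(e·d·d)
  -- would be dominated by the lower power w^(d·e).
  fg-forces-affine : ∀ {F G pF pG} → DeltaMap F → DeltaMap G → PolyFn F pF → PolyFn G pG →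
                     (∀ {w} → OnGrid w → G (G (F w)) ≤ F (G w)) → deg pG N.≤ 1
  fg-forces-affine {F} {G} {pF} {pG} δF δG F≡ G≡ rule with deg pG N.≤? 1
  ... | yes d≤1 = d≤1
  ... | no d≰1 = ⊥-elim (power-gap {κ} {K} 0<κ exponents
                   (unbounded-map compare (unbounded-∧ (eventually-≥ Y) grid-unbounded)))
    where
    open Composites δF δG F≡ G≡ (NP.≰⇒> d≰1)
    compare : ∀ {u} → Y ≤ u × OnGrid u → κ * u ^ (e N.* d N.* d) ≤ K * u ^ (d N.* e)
    compare (Y≤u , on) = ≤-trans (lower Y≤u on) (≤-trans (rule on) (upper Y≤u on))

2ℚ : ℚ
2ℚ = 1ℚ + 1ℚ

-- √2 is irrational: a² = 2d² has no solution with a, d coprime, since 2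
-- would divide both.
no-rational-√2 : ∀ q → q * q ≢ 2ℚ
no-rational-√2 q@(mkℚ n d-1 coprime) q²≡2 = 2≢1 (coprime (2∣a , 2∣d))
  where
  open import Data.Nat.Divisibility using (_∣_; divides)
  open import Data.Nat.Primality using (euclidsLemma; prime[2])
  a = Z.∣ n ∣
  d = suc d-1
  2≢1 : .(2 ≡ 1) → ⊥
  2≢1 ()
  2∣-square : ∀ b → 2 ∣ b N.* b → 2 ∣ b
  2∣-square b 2∣b² with euclidsLemma b b prime[2] 2∣b²
  ... | inj₁ 2∣b = 2∣b
  ... | inj₂ 2∣b = 2∣b
  a²≡2d² : a N.* a ≡ 2 N.* (d N.* d)
  a²≡2d² with UP.≃-trans (UP.≃-sym (toℚᵘ-homo-* q q))
                (UP.≃-trans (UP.≃-reflexive (cong toℚᵘ q²≡2)) (ι-unnormalised (Z.+ 2)))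
  ... | U.*≡* eq = begin
    a N.* a                          ≡⟨ sym (ZP.abs-* n n) ⟩
    Z.∣ n Z.* n ∣                    ≡⟨ cong Z.∣_∣ (sym (ZP.*-identityʳ (n Z.* n))) ⟩
    Z.∣ n Z.* n Z.* Z.+ 1 ∣          ≡⟨ cong Z.∣_∣ eq ⟩
    Z.∣ Z.+ 2 Z.* Z.+ (d N.* d) ∣    ≡⟨ ZP.abs-* (Z.+ 2) (Z.+ (d N.* d)) ⟩
    2 N.* (d N.* d)                  ∎
    where open ≡-Reasoning
  2∣a : 2 ∣ a
  2∣a = 2∣-square a (divides (d N.* d) (trans a²≡2d² (NP.*-comm 2 (d N.* d))))
  -- Writing a = 2k gives d² = 2k², so 2 divides d as well.
  k = _∣_.quotient 2∣a
  d²≡2k² : d N.* d ≡ 2 N.* (k N.* k)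
  d²≡2k² = NP.*-cancelˡ-≡ (d N.* d) (2 N.* (k N.* k)) 2 (begin
    2 N.* (d N.* d)          ≡⟨ sym a²≡2d² ⟩
    a N.* a                  ≡⟨ cong (λ b → b N.* b) (_∣_.equality 2∣a) ⟩
    k N.* 2 N.* (k N.* 2)    ≡⟨ NS.solve 1 (λ k → k NS.:* NS.con 2 NS.:* (k NS.:* NS.con 2)
                                                NS.:= NS.con 2 NS.:* (NS.con 2 NS.:* (k NS.:* k))) refl k ⟩
    2 N.* (2 N.* (k N.* k))  ∎)
    where
    open ≡-Reasoning
    import Data.Nat.Solver
    module NS = Data.Nat.Solver.+-*-Solver
  2∣d : 2 ∣ d
  2∣d = 2∣-square d (divides (k N.* k) (trans d²≡2k² (NP.*-comm 2 (k N.* k))))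

-- What both halves of the theorem provide: a polynomial algebra over ℚ
-- that is closed and δ-monotone on a set Dom ⊆ ℚ₀ containing δℕ and weakly
-- compatible with R₄ (over ℕ, Dom is the image of ℕ and δ = 1).
record MonotoneModel : Set₁ where
  field
    δ          : ℚ
    0<δ        : 0ℚ < δ
    polys      : Polys ℚ
    Dom        : ℚ → Set
    Dom-nonNeg : ∀ {w} → Dom w → 0ℚ ≤ w
    grid⊆Dom   : ∀ n → Dom (Grid.gridPoint 0<δ n)
    closed     : Closed Dom (toAlg _+_ _*_ polys)
    monotone   : Monotone Dom (λ y z → δ ≤ y - z) (toAlg _+_ _*_ polys)
    compatible : Compatible Dom (λ y z → z ≤ y) (toAlg _+_ _*_ polys) R₄

-- Writing S, F, G, K, H for the interpretations:
--   1. f(g x) ≥ g(g(f x)) makes G affine, G w = g₀ + g₁ w;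
--   2. g(s x) ≥ s(s(g x)) then makes S affine, S w = s₀ + s₁ w, with s₁ ≤ 1;
--   3. s x ≥ h(0, x), h(x, 0) and g x ≥ h(x, x) make the restriction of H
--      to the diagonal affine; by the chain rule its slope is at most
--      s₁ + s₁ ≤ 2, and monotonicity makes it at least 2;
--   4. the two k-rules then make K affine with slope m satisfying
--      2m ≤ m³ ≤ 2m, i.e. m² = 2, which no rational satisfies.
module NoMonotoneModel (𝓜 : MonotoneModel) where
  open MonotoneModel 𝓜
  open DeltaMonotone 0<δ Dom Dom-nonNeg grid⊆Dom

  𝒜 : Alg ℚ
  𝒜 = toAlg _+_ _*_ polys

  S F G K : ℚ → ℚ
  S = as 𝒜
  F = af 𝒜
  G = ag 𝒜
  K = ak 𝒜

  H : ℚ → ℚ → ℚ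
  H = ah 𝒜

  c : ℚ
  c = a0 𝒜

  c∈Dom : Dom c
  c∈Dom = proj₁ closed

  δS : DeltaMap S
  δS = record { closed = proj₁ (proj₂ closed) ; mono = proj₁ monotone }

  δF : DeltaMap F
  δF = record { closed = proj₁ (proj₂ (proj₂ closed)) ; mono = proj₁ (proj₂ monotone) }

  δG : DeltaMap G
  δG = record { closed = proj₁ (proj₂ (proj₂ (proj₂ closed))) ; mono = proj₁ (proj₂ (proj₂ monotone)) }

  δK : DeltaMap K
  δK = record { closed = proj₁ (proj₂ (proj₂ (proj₂ (proj₂ closed))))
              ; mono = proj₁ (proj₂ (proj₂ (proj₂ monotone))) }

  H-closed : ∀ y z → Dom y → Dom z → Dom (H y z)
  H-closed = proj₂ (proj₂ (proj₂ (proj₂ (proj₂ closed))))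

  H-diagonal-increasing : ∀ {w} → OnGrid w → w + w ≤ H w w
  H-diagonal-increasing = diagonal-increasing H H-closed
    (proj₁ (proj₂ (proj₂ (proj₂ (proj₂ monotone))))) (proj₂ (proj₂ (proj₂ (proj₂ (proj₂ monotone)))))

  rule : ∀ {l r} → (l , r) ∈ R₄rules → ∀ {u} → Dom u → ⟦ 𝒜 ⟧ (λ _ → u) r ≤ ⟦ 𝒜 ⟧ (λ _ → u) l
  rule l→r {u} u∈Dom = compatible _ _ l→r (λ _ → u) (λ _ → u∈Dom)

  rule-fg : ∀ {u} → Dom u → G (G (F u)) ≤ F (G u)
  rule-fg = rule (here refl)

  rule-gs : ∀ {u} → Dom u → S (S (G u)) ≤ G (S u)
  rule-gs = rule (there (here refl))

  rule-g : ∀ {u} → Dom u → H u u ≤ G u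
  rule-g = rule (there (there (here refl)))

  rule-s₁ : ∀ {u} → Dom u → H c u ≤ S u
  rule-s₁ = rule (there (there (there (here refl))))

  rule-s₂ : ∀ {u} → Dom u → H u c ≤ S u
  rule-s₂ = rule (there (there (there (there (here refl)))))

  rule-k : ∀ {u} → Dom u → H (K u) (K u) ≤ K (K (K u))
  rule-k = rule (there (there (there (there (there (here refl))))))

  rule-sk : ∀ {u} → Dom u → K (K (K u)) ≤ S (H (K u) (K u))
  rule-sk = rule (there (there (there (there (there (there (here refl)))))))

  sᶜ fᶜ gᶜ kᶜ : List ℚ
  sᶜ = unaryᶜ (Polys.ps polys)
  fᶜ = unaryᶜ (Polys.pf polys)
  gᶜ = unaryᶜ (Polys.pg polys)
  kᶜ = unaryᶜ (Polys.pk polys)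

  S-poly : PolyFn S sᶜ
  S-poly = unary-polyFn (Polys.ps polys)

  F-poly : PolyFn F fᶜ
  F-poly = unary-polyFn (Polys.pf polys)

  G-poly : PolyFn G gᶜ
  G-poly = unary-polyFn (Polys.pg polys)

  K-poly : PolyFn K kᶜ
  K-poly = unary-polyFn (Polys.pk polys)

  G-affine : deg gᶜ N.≤ 1
  G-affine = fg-forces-affine δF δG F-poly G-poly (λ on → rule-fg (onGrid-Dom on))

  g₀ g₁ : ℚ
  g₀ = coeff₀ gᶜ
  g₁ = coeff₁ gᶜ

  G≡ : ∀ w → G w ≡ g₀ + g₁ * w
  G≡ w = trans (evalsTo G-poly w) (affine-eval gᶜ G-affine w)

  0≤g₁ : 0ℚ ≤ g₁
  0≤g₁ = ≤-trans (<⇒≤ 0<1) (slope≥1 g₀ g₁ δG G≡)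

  -- Step 2: S is affine.  At v = S (G u), u ≥ δ on the grid, the rule
  -- g(s x) → s(s(g x)) gives S v ≤ G (S u) ≤ g₀ + g₁ v, because
  -- G u ≥ H(u, u) ≥ u + δ and hence S u ≤ S (G u).
  S-below-G : Unbounded (λ v → S v ≤ g₀ + g₁ * v)
  S-below-G = unbounded-image (λ u → S (G u)) step (unbounded-∧ (eventually-≥ δ) grid-unbounded)
    where
    step : ∀ {u} → δ ≤ u × OnGrid u → u ≤ S (G u) × S (S (G u)) ≤ g₀ + g₁ * S (G u)
    step {u} (δ≤u , on) = ≤-trans (grid-increasing δS on) Su≤SGu , (begin
      S (S (G u))        ≤⟨ rule-gs u∈Dom ⟩
      G (S u)            ≡⟨ G≡ (S u) ⟩
      g₀ + g₁ * S u      ≤⟨ +-monoʳ-≤ g₀ (*-monoˡ-≤ 0≤g₁ Su≤SGu) ⟩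
      g₀ + g₁ * S (G u)  ∎)
      where
      open ≤-Reasoning
      u∈Dom = onGrid-Dom on
      u+δ≤Gu : u + δ ≤ G u
      u+δ≤Gu = ≤-trans (+-monoʳ-≤ u δ≤u) (≤-trans (H-diagonal-increasing on) (rule-g u∈Dom))
      Su≤SGu : S u ≤ S (G u)
      Su≤SGu = ≤-trans (≤-trans (≤-reflexive (sym (+-identityʳ (S u)))) (+-monoʳ-≤ (S u) (<⇒≤ 0<δ)))
                       (delta-step S (DeltaMap.mono δS) (DeltaMap.closed δG u u∈Dom) u∈Dom u+δ≤Gu)

  S-affine : deg sᶜ N.≤ 1
  S-affine = proj₁ (affinely-bounded g₀ g₁ S-poly (grid-nonNeg δS) S-below-G)

  s₀ s₁ : ℚ
  s₀ = coeff₀ sᶜ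
  s₁ = coeff₁ sᶜ

  S≡ : ∀ w → S w ≡ s₀ + s₁ * w
  S≡ w = trans (evalsTo S-poly w) (affine-eval sᶜ S-affine w)

  -- Comparing the slopes s₁² g₁ and g₁ s₁ of both sides of g(s x) → s(s(g x)).
  s₁≤1 : s₁ ≤ 1ℚ
  s₁≤1 = *-cancelˡ-≤-pos (g₁ * s₁) {{positive 0<g₁s₁}} (begin
    g₁ * s₁ * s₁     ≡⟨ solve 2 (λ g s → g :* s :* s := s :* s :* g) refl g₁ s₁ ⟩
    s₁ * s₁ * g₁     ≤⟨ slope-≤ (s₀ + s₁ * s₀ + s₁ * s₁ * g₀) (g₀ + g₁ * s₀)
                                (unbounded-map composite-slopes grid-unbounded) ⟩
    g₁ * s₁          ≡⟨ sym (*-identityʳ (g₁ * s₁)) ⟩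
    g₁ * s₁ * 1ℚ     ∎)
    where
    open ≤-Reasoning
    0<g₁s₁ = *-pos (<-≤-trans 0<1 (slope≥1 g₀ g₁ δG G≡)) (<-≤-trans 0<1 (slope≥1 s₀ s₁ δS S≡))
    composite-slopes : ∀ {u} → OnGrid u →
      (s₀ + s₁ * s₀ + s₁ * s₁ * g₀) + s₁ * s₁ * g₁ * u ≤ (g₀ + g₁ * s₀) + g₁ * s₁ * u
    composite-slopes {u} on = begin
      (s₀ + s₁ * s₀ + s₁ * s₁ * g₀) + s₁ * s₁ * g₁ * u
        ≡⟨ solve 5 (λ s₀ s₁ g₀ g₁ u → (s₀ :+ s₁ :* s₀ :+ s₁ :* s₁ :* g₀) :+ s₁ :* s₁ :* g₁ :* u
                                     := s₀ :+ s₁ :* (s₀ :+ s₁ :* (g₀ :+ g₁ :* u))) refl s₀ s₁ g₀ g₁ u ⟩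
      s₀ + s₁ * (s₀ + s₁ * (g₀ + g₁ * u))
        ≡⟨ sym (trans (S≡ _) (cong (λ z → s₀ + s₁ * z) (trans (S≡ _) (cong (λ z → s₀ + s₁ * z) (G≡ u))))) ⟩
      S (S (G u))                            ≤⟨ rule-gs (onGrid-Dom on) ⟩
      G (S u)                                ≡⟨ trans (G≡ _) (cong (λ z → g₀ + g₁ * z) (S≡ u)) ⟩
      g₀ + g₁ * (s₀ + s₁ * u)
        ≡⟨ solve 5 (λ s₀ s₁ g₀ g₁ u → g₀ :+ g₁ :* (s₀ :+ s₁ :* u) := (g₀ :+ g₁ :* s₀) :+ g₁ :* s₁ :* u)
                 refl s₀ s₁ g₀ g₁ u ⟩
      (g₀ + g₁ * s₀) + g₁ * s₁ * u           ∎

  -- Step 3: along the diagonal, H (w, w) = φ₀ + 2 (w - c).  Consider the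
  -- restrictions of H to the three lines through (c, c), as polynomials
  -- in t = w - c.
  diagᶜ firstᶜ secondᶜ : List ℚ
  diagᶜ   = substC (Polys.ph polys) (moveBoth c)
  firstᶜ  = substC (Polys.ph polys) (moveFirst c)
  secondᶜ = substC (Polys.ph polys) (moveSecond c)

  H-at : ∀ σ {y z} t → evalC (σ Fin.zero) t ≡ y → evalC (σ (Fin.suc Fin.zero)) t ≡ z →
         H y z ≡ evalC (substC (Polys.ph polys) σ) t
  H-at σ t σ₀≡y σ₁≡z = trans (evalP-cong {_⊞_ = _+_} {_*_} (Polys.ph polys)
                                  λ { Fin.zero → sym σ₀≡y ; (Fin.suc Fin.zero) → sym σ₁≡z })
                             (sym (evalC-substC (Polys.ph polys) σ t))

  moving : ∀ t → evalC (c ∷ 1ℚ ∷ []) t ≡ c + t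
  moving t = solve 2 (λ c t → c :+ t :* (con 1ℚ :+ t :* con 0ℚ) := c :+ t) refl c t

  fixed : ∀ t → evalC (c ∷ []) t ≡ c
  fixed t = solve 2 (λ c t → c :+ t :* con 0ℚ := c) refl c t

  diag-poly : PolyFn (λ t → H (c + t) (c + t)) diagᶜ
  diag-poly = polyFn λ t → H-at (moveBoth c) t (moving t) (moving t)

  first-poly : PolyFn (λ t → H (c + t) c) firstᶜ
  first-poly = polyFn λ t → H-at (moveFirst c) t (moving t) (fixed t)

  second-poly : PolyFn (λ t → H c (c + t)) secondᶜ
  second-poly = polyFn λ t → H-at (moveSecond c) t (fixed t) (moving t)

  shifted-grid : ∀ {P : ℚ → Set} → (∀ {w} → OnGrid w → P w) → Unbounded (λ t → P (c + t))
  shifted-grid {P} P-on-grid = unbounded-shift {P} c (unbounded-map P-on-grid grid-unbounded)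

  shifted-affine : ∀ a b t → a + b * (c + t) ≡ (a + b * c) + b * t
  shifted-affine a b t = solve 4 (λ a b c t → a :+ b :* (c :+ t) := (a :+ b :* c) :+ b :* t) refl a b c t

  -- The rules s x → h(x, 0) and s x → h(0, x) make the restrictions
  -- t ↦ H (c + t, c) and t ↦ H (c, c + t) affine with slope at most s₁.
  S-shifted : ∀ t → S (c + t) ≡ (s₀ + s₁ * c) + s₁ * t
  S-shifted t = trans (S≡ (c + t)) (shifted-affine s₀ s₁ t)

  first-slope : coeff₁ firstᶜ ≤ s₁
  first-slope = proj₂ (affinely-bounded (s₀ + s₁ * c) s₁ first-poly
    (shifted-grid {λ w → 0ℚ ≤ H w c} (λ on → Dom-nonNeg (H-closed _ _ (onGrid-Dom on) c∈Dom)))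
    (unbounded-map (λ {t} le → ≤-trans le (≤-reflexive (S-shifted t)))
      (shifted-grid {λ w → H w c ≤ S w} (λ on → rule-s₂ (onGrid-Dom on)))))

  second-slope : coeff₁ secondᶜ ≤ s₁
  second-slope = proj₂ (affinely-bounded (s₀ + s₁ * c) s₁ second-poly
    (shifted-grid {λ w → 0ℚ ≤ H c w} (λ on → Dom-nonNeg (H-closed _ _ c∈Dom (onGrid-Dom on))))
    (unbounded-map (λ {t} le → ≤-trans le (≤-reflexive (S-shifted t)))
      (shifted-grid {λ w → H c w ≤ S w} (λ on → rule-s₁ (onGrid-Dom on)))))

  -- The rule g x → h(x, x) makes the diagonal restriction affine.
  diag-affine : deg diagᶜ N.≤ 1
  diag-affine = proj₁ (affinely-bounded (g₀ + g₁ * c) g₁ diag-poly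
    (shifted-grid {λ w → 0ℚ ≤ H w w} (λ on → Dom-nonNeg (H-closed _ _ (onGrid-Dom on) (onGrid-Dom on))))
    (unbounded-map (λ {t} le → ≤-trans le (≤-reflexive (trans (G≡ (c + t)) (shifted-affine g₀ g₁ t))))
      (shifted-grid {λ w → H w w ≤ G w} (λ on → rule-g (onGrid-Dom on)))))

  φ₀ φ₁ : ℚ
  φ₀ = coeff₀ diagᶜ
  φ₁ = coeff₁ diagᶜ

  diag≡ : ∀ t → H (c + t) (c + t) ≡ φ₀ + φ₁ * t
  diag≡ t = trans (evalsTo diag-poly t) (affine-eval diagᶜ diag-affine t)

  -- By the chain rule, φ₁ is the sum of the partial slopes, so φ₁ ≤ 2 …
  φ₁≤2 : φ₁ ≤ 2ℚ
  φ₁≤2 = begin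
    φ₁                                ≡⟨ FirstOrderSplit.slope (diagonal-split (Polys.ph polys) c) ⟩
    coeff₁ firstᶜ + coeff₁ secondᶜ    ≤⟨ +-mono-≤ (≤-trans first-slope s₁≤1) (≤-trans second-slope s₁≤1) ⟩
    2ℚ                                ∎
    where open ≤-Reasoning

  -- … while monotonicity in both arguments gives H (w, w) ≥ 2w, so φ₁ ≥ 2.
  2≤φ₁ : 2ℚ ≤ φ₁
  2≤φ₁ = slope-≤ (c + c) φ₀ (unbounded-map (λ {t} le → ≤-trans (≤-reflexive (doubled t)) (≤-trans le (≤-reflexive (diag≡ t))))
                              (shifted-grid {λ w → w + w ≤ H w w} H-diagonal-increasing))
    where
    doubled : ∀ t → c + c + 2ℚ * t ≡ (c + t) + (c + t)
    doubled t = solve 2 (λ c t → c :+ c :+ con 2ℚ :* t := (c :+ t) :+ (c :+ t)) refl c t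

  H-diagonal : ∀ w → H w w ≡ φ₀ + 2ℚ * (w - c)
  H-diagonal w = begin
    H w w                             ≡⟨ cong (λ z → H z z) (sym (solve 2 (λ c w → c :+ (w :- c) := w) refl c w)) ⟩
    H (c + (w - c)) (c + (w - c))     ≡⟨ diag≡ (w - c) ⟩
    φ₀ + φ₁ * (w - c)                 ≡⟨ cong (λ r → φ₀ + r * (w - c)) (≤-antisym φ₁≤2 2≤φ₁) ⟩
    φ₀ + 2ℚ * (w - c)                 ∎
    where open ≡-Reasoning

  -- Step 4: K is affine with slope m, m² = 2.  The rule
  -- s(h(k x, k x)) → k(k(k x)) with s₁ ≤ 1 gives K³ u ≤ C + 2 K u.
  C : ℚ
  C = s₀ + φ₀ - 2ℚ * c

  K³-bound : ∀ {u} → Dom u → K (K (K u)) ≤ C + 2ℚ * K u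
  K³-bound {u} u∈Dom = begin
    K (K (K u))                    ≤⟨ rule-sk u∈Dom ⟩
    S (H (K u) (K u))              ≡⟨ S≡ _ ⟩
    s₀ + s₁ * H (K u) (K u)        ≤⟨ +-monoʳ-≤ s₀ (*-monoʳ-≤ (Dom-nonNeg (H-closed _ _ Ku∈Dom Ku∈Dom)) s₁≤1) ⟩
    s₀ + 1ℚ * H (K u) (K u)        ≡⟨ cong (λ z → s₀ + 1ℚ * z) (H-diagonal (K u)) ⟩
    s₀ + 1ℚ * (φ₀ + 2ℚ * (K u - c))
      ≡⟨ solve 4 (λ s φ k c → s :+ con 1ℚ :* (φ :+ con 2ℚ :* (k :- c)) := (s :+ φ :- con 2ℚ :* c) :+ con 2ℚ :* k)
               refl s₀ φ₀ (K u) c ⟩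
    C + 2ℚ * K u                   ∎
    where
    open ≤-Reasoning
    Ku∈Dom = DeltaMap.closed δK u u∈Dom

  -- A superlinear K would violate this bound at v = K (K u).
  K-affine : deg kᶜ N.≤ 1
  K-affine with deg kᶜ N.≤? 1
  ... | yes d≤1 = d≤1
  ... | no d≰1 = ⊥-elim (superlinear-unbounded {K} {C} {2ℚ} K-superlinear K-below)
    where
    2≤d = NP.≰⇒> d≰1
    K-superlinear = superlinear K-poly 2≤d
      (lead-pos K-poly (1≤deg⇒nonzero kᶜ (NP.≤-trans (N.s≤s N.z≤n) 2≤d)) (grid-nonNeg δK))
    Y = proj₁ (K-superlinear 1ℚ)
    K-dominates : ∀ {w} → Y ≤ w → w ≤ K w
    K-dominates {w} Y≤w = ≤-trans (≤-reflexive (sym (*-identityˡ w))) (proj₂ (K-superlinear 1ℚ) w Y≤w)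
    step : ∀ {u} → Y ≤ u × OnGrid u → u ≤ K (K u) × K (K (K u)) ≤ C + 2ℚ * K (K u)
    step {u} (Y≤u , on) = ≤-trans u≤Ku Ku≤KKu ,
      ≤-trans (K³-bound (onGrid-Dom on)) (+-monoʳ-≤ C (*-monoˡ-≤ (<⇒≤ 0<2) Ku≤KKu))
      where
      u≤Ku = grid-increasing δK on
      Ku≤KKu = K-dominates (≤-trans Y≤u u≤Ku)
      0<2 = +-mono-< 0<1 0<1
    K-below : Unbounded (λ v → K v ≤ C + 2ℚ * v)
    K-below = unbounded-image (λ u → K (K u)) step (unbounded-∧ (eventually-≥ Y) grid-unbounded)

  k₀ m : ℚ
  k₀ = coeff₀ kᶜ
  m  = coeff₁ kᶜ

  K≡ : ∀ w → K w ≡ k₀ + m * w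
  K≡ w = trans (evalsTo K-poly w) (affine-eval kᶜ K-affine w)

  K³≡ : ∀ u → K (K (K u)) ≡ (k₀ + m * k₀ + m * m * k₀) + m * m * m * u
  K³≡ u = begin
    K (K (K u))
      ≡⟨ trans (K≡ _) (cong (λ z → k₀ + m * z) (trans (K≡ _) (cong (λ z → k₀ + m * z) (K≡ u)))) ⟩
    k₀ + m * (k₀ + m * (k₀ + m * u))         ≡⟨ solve 3 (λ k m u → k :+ m :* (k :+ m :* (k :+ m :* u))
                                                         := (k :+ m :* k :+ m :* m :* k) :+ m :* m :* m :* u) refl k₀ m u ⟩
    (k₀ + m * k₀ + m * m * k₀) + m * m * m * u ∎
    where open ≡-Reasoning

  -- The rule k(k(k x)) → h(k x, k x) compares slopes 2m ≤ m³ …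
  2m≤m³ : 2ℚ * m ≤ m * m * m
  2m≤m³ = slope-≤ (φ₀ + 2ℚ * (k₀ - c)) (k₀ + m * k₀ + m * m * k₀)
    (unbounded-map (λ {u} on → ≤-trans (≤-reflexive (sym (HK≡ u))) (≤-trans (rule-k (onGrid-Dom on)) (≤-reflexive (K³≡ u))))
                   grid-unbounded)
    where
    HK≡ : ∀ u → H (K u) (K u) ≡ (φ₀ + 2ℚ * (k₀ - c)) + 2ℚ * m * u
    HK≡ u = trans (H-diagonal (K u)) (trans (cong (λ z → φ₀ + 2ℚ * (z - c)) (K≡ u))
      (solve 5 (λ φ k m u c → φ :+ con 2ℚ :* ((k :+ m :* u) :- c) := (φ :+ con 2ℚ :* (k :- c)) :+ con 2ℚ :* m :* u)
             refl φ₀ k₀ m u c))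

  -- … and K³-bound the reverse m³ ≤ 2m.
  m³≤2m : m * m * m ≤ 2ℚ * m
  m³≤2m = slope-≤ (k₀ + m * k₀ + m * m * k₀) (C + 2ℚ * k₀)
    (unbounded-map (λ {u} on → ≤-trans (≤-reflexive (sym (K³≡ u))) (≤-trans (K³-bound (onGrid-Dom on)) (≤-reflexive (twiceK≡ u))))
                   grid-unbounded)
    where
    twiceK≡ : ∀ u → C + 2ℚ * K u ≡ (C + 2ℚ * k₀) + 2ℚ * m * u
    twiceK≡ u = trans (cong (λ z → C + 2ℚ * z) (K≡ u))
      (solve 4 (λ C k m u → C :+ con 2ℚ :* (k :+ m :* u) := (C :+ con 2ℚ :* k) :+ con 2ℚ :* m :* u) refl C k₀ m u)

  m²≡2 : m * m ≡ 2ℚ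
  m²≡2 = ≤-antisym (*-cancelʳ-≤-pos m {{positive 0<m}} m³≤2m) (*-cancelʳ-≤-pos m {{positive 0<m}} 2m≤m³)
    where
    0<m = <-≤-trans 0<1 (slope≥1 k₀ m δK K≡)

  absurd : ⊥
  absurd = no-rational-√2 m m²≡2

record AlgHom {C D : Set} (φ : C → D) (A : Alg C) (B : Alg D) : Set where
  field
    hom-0 : a0 B ≡ φ (a0 A)
    hom-s : ∀ y → as B (φ y) ≡ φ (as A y)
    hom-f : ∀ y → af B (φ y) ≡ φ (af A y)
    hom-g : ∀ y → ag B (φ y) ≡ φ (ag A y)
    hom-k : ∀ y → ak B (φ y) ≡ φ (ak A y)
    hom-h : ∀ y z → ah B (φ y) (φ z) ≡ φ (ah A y z)

Image : ∀ {C D : Set} → (C → D) → (C → Set) → D → Set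
Image φ Dom w = Σ _ λ z → Dom z × w ≡ φ z

module _ {C D : Set} {φ : C → D} {A : Alg C} {B : Alg D} (hom : AlgHom φ A B) where
  open AlgHom hom

  ⟦⟧-hom : ∀ {α β} → (∀ n → α n ≡ φ (β n)) → ∀ t → ⟦ B ⟧ α t ≡ φ (⟦ A ⟧ β t)
  ⟦⟧-hom α≡φβ (Defs.var n) = α≡φβ n
  ⟦⟧-hom α≡φβ Defs.𝟎       = hom-0
  ⟦⟧-hom α≡φβ (Defs.s t)   = trans (cong (as B) (⟦⟧-hom α≡φβ t)) (hom-s _)
  ⟦⟧-hom α≡φβ (Defs.f t)   = trans (cong (af B) (⟦⟧-hom α≡φβ t)) (hom-f _)
  ⟦⟧-hom α≡φβ (Defs.g t)   = trans (cong (ag B) (⟦⟧-hom α≡φβ t)) (hom-g _)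
  ⟦⟧-hom α≡φβ (Defs.k t)   = trans (cong (ak B) (⟦⟧-hom α≡φβ t)) (hom-k _)
  ⟦⟧-hom α≡φβ (Defs.h t u) = trans (cong₂ (ah B) (⟦⟧-hom α≡φβ t) (⟦⟧-hom α≡φβ u)) (hom-h _ _)

  image-closed : ∀ {Dom} → Closed Dom A → Closed (Image φ Dom) B
  image-closed (c₀ , cs , cf , cg , ck , ch) =
      (a0 A , c₀ , hom-0)
    , unary (as A) (as B) hom-s cs , unary (af A) (af B) hom-f cf
    , unary (ag A) (ag B) hom-g cg , unary (ak A) (ak B) hom-k ck
    , λ { _ _ (y , y∈ , refl) (z , z∈ , refl) → ah A y z , ch y z y∈ z∈ , hom-h y z }
    where
    unary : ∀ {Dom} (FA : C → C) (FB : D → D) → (∀ y → FB (φ y) ≡ φ (FA y)) →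
            (∀ y → Dom y → Dom (FA y)) → ∀ w → Image φ Dom w → Image φ Dom (FB w)
    unary FA FB hom-F closed-F _ (y , y∈ , refl) = FA y , closed-F y y∈ , hom-F y

  image-monotone : ∀ {Dom _≻ᴬ_ _≻ᴮ_} →
    (∀ {y z} → φ y ≻ᴮ φ z → y ≻ᴬ z) → (∀ {y z} → y ≻ᴬ z → φ y ≻ᴮ φ z) →
    Monotone Dom _≻ᴬ_ A → Monotone (Image φ Dom) _≻ᴮ_ B
  image-monotone {Dom} {_≻ᴬ_} {_≻ᴮ_} reflect preserve (ms , mf , mg , mk , mh₁ , mh₂) =
      unary hom-s ms , unary hom-f mf , unary hom-g mg , unary hom-k mk
    , (λ { _ (z , z∈ , refl) → unary (λ y → hom-h y z) (mh₁ z z∈) })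
    , (λ { _ (z , z∈ , refl) → unary (λ y → hom-h z y) (mh₂ z z∈) })
    where
    unary : ∀ {FA : C → C} {FB : D → D} → (∀ y → FB (φ y) ≡ φ (FA y)) →
            MonoUnary Dom _≻ᴬ_ FA → MonoUnary (Image φ Dom) _≻ᴮ_ FB
    unary {FA} {FB} hom-F mono _ _ (y , y∈ , refl) (y′ , y′∈ , refl) y≻y′ =
      subst₂ _≻ᴮ_ (sym (hom-F y)) (sym (hom-F y′)) (preserve (mono y y′ y∈ y′∈ (reflect y≻y′)))

  image-compatible : ∀ {Dom _≽ᴬ_ _≽ᴮ_ R} → (∀ {y z} → y ≽ᴬ z → φ y ≽ᴮ φ z) →
    Compatible Dom _≽ᴬ_ A R → Compatible (Image φ Dom) _≽ᴮ_ B R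
  image-compatible {_≽ᴮ_ = _≽ᴮ_} preserve compat l r l→r α α∈ =
    subst₂ _≽ᴮ_ (sym (⟦⟧-hom α≡φβ l)) (sym (⟦⟧-hom α≡φβ r))
           (preserve (compat l r l→r β (λ n → proj₁ (proj₂ (α∈ n)))))
    where
    β = λ n → proj₁ (α∈ n)
    α≡φβ = λ n → proj₂ (proj₂ (α∈ n))

module FirstStep {PI C : Set} (alg : PI → Alg C) (Dom : C → Set)
  (Gt : PI → C → C → Set) (Ge : C → C → Set) (strict⇒weak : ∀ P {y z} → Gt P y z → Ge y z) where
  open Termination alg Dom Gt Ge

  first-interpretation : ∀ {R n} → PolyTermIn R n →
                         Σ PI λ P → StrictlyMonotone P × Compatible Dom Ge (alg P) R
  first-interpretation (one (P , mono , compat)) =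
    P , mono , λ l r l→r α α∈ → strict⇒weak P (compat l r l→r α α∈)
  first-interpretation (step P _ _ _ _ _ mono compat _ _) = P , mono , compat

ℚ-model : (P : QInterp) → OverQ.StrictlyMonotone P → Compatible ℚ₀ Geℚ (algℚ P) R₄ → MonotoneModel
ℚ-model P mono compat = record
  { δ = QInterp.δ P ; 0<δ = QInterp.δ-pos P ; polys = QInterp.polys P
  ; Dom = ℚ₀ ; Dom-nonNeg = λ 0≤w → 0≤w
  ; grid⊆Dom = λ n → *-nonNeg (<⇒≤ (QInterp.δ-pos P)) (ι-mono {Z.+ 0} {Z.+ n} (Z.+≤+ N.z≤n))
  ; closed = QInterp.closed P ; monotone = mono ; compatible = compat }

mapPoly : ∀ {n} → Poly ℤ n → Poly ℚ n
mapPoly (con a)  = con (ι a)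
mapPoly (pvar i) = pvar i
mapPoly (P ⊕ Q)  = mapPoly P ⊕ mapPoly Q
mapPoly (P ⊗ Q)  = mapPoly P ⊗ mapPoly Q

mapPoly-eval : ∀ {n} (P : Poly ℤ n) ρ → evalP _+_ _*_ (mapPoly P) (λ i → ι (ρ i)) ≡ ι (evalP Z._+_ Z._*_ P ρ)
mapPoly-eval (con a)  ρ = refl
mapPoly-eval (pvar i) ρ = refl
mapPoly-eval (P ⊕ Q)  ρ =
  trans (cong₂ _+_ (mapPoly-eval P ρ) (mapPoly-eval Q ρ)) (sym (ι-+ (evalP Z._+_ Z._*_ P ρ) (evalP Z._+_ Z._*_ Q ρ)))
mapPoly-eval (P ⊗ Q)  ρ =
  trans (cong₂ _*_ (mapPoly-eval P ρ) (mapPoly-eval Q ρ)) (sym (ι-* (evalP Z._+_ Z._*_ P ρ) (evalP Z._+_ Z._*_ Q ρ)))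

mapPolys : Polys ℤ → Polys ℚ
mapPolys P = record
  { p0 = mapPoly (Polys.p0 P) ; ps = mapPoly (Polys.ps P) ; pf = mapPoly (Polys.pf P)
  ; pg = mapPoly (Polys.pg P) ; pk = mapPoly (Polys.pk P) ; ph = mapPoly (Polys.ph P) }

ι-hom : ∀ P → AlgHom ι (toAlg Z._+_ Z._*_ P) (toAlg _+_ _*_ (mapPolys P))
ι-hom P = record
  { hom-0 = trans (evalP-cong {_⊞_ = _+_} {_*_} (mapPoly (Polys.p0 P)) (λ ())) (mapPoly-eval (Polys.p0 P) (λ ()))
  ; hom-s = λ y → mapPoly-eval (Polys.ps P) (λ _ → y)
  ; hom-f = λ y → mapPoly-eval (Polys.pf P) (λ _ → y)
  ; hom-g = λ y → mapPoly-eval (Polys.pg P) (λ _ → y)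
  ; hom-k = λ y → mapPoly-eval (Polys.pk P) (λ _ → y)
  ; hom-h = λ y z → trans (evalP-cong {_⊞_ = _+_} {_*_} (mapPoly (Polys.ph P)) {ρ′ = λ i → ι (pair y z i)}
                                       λ { Fin.zero → refl ; (Fin.suc Fin.zero) → refl })
                    (trans (mapPoly-eval (Polys.ph P) (pair y z))
                           (cong ι (evalP-cong {_⊞_ = Z._+_} {Z._*_} (Polys.ph P)
                                       λ { Fin.zero → refl ; (Fin.suc Fin.zero) → refl }))) }
  where
  pair : ℤ → ℤ → Fin 2 → ℤ
  pair y z Fin.zero    = y
  pair y z (Fin.suc _) = z

ι-suc : ∀ b → ι (Z.suc b) ≡ ι b + 1ℚ
ι-suc b = trans (ι-+ (Z.+ 1) b) (+-comm 1ℚ (ι b))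

ι-gap : ∀ {a b} → 1ℚ ≤ ι a - ι b → b Z.< a
ι-gap {a} {b} 1≤diff = ZP.suc[i]≤j⇒i<j (ι-cancel (≤-trans (≤-reflexive (ι-suc b))
  (≤-rearrange 1≤diff (solve 2 (λ x y → x :- (y :+ con 1ℚ) := (x :- y) :- con 1ℚ) refl (ι a) (ι b)))))

ι-gap⁻¹ : ∀ {a b} → b Z.< a → 1ℚ ≤ ι a - ι b
ι-gap⁻¹ {a} {b} b<a = ≤-rearrange (≤-trans (≤-reflexive (sym (ι-suc b))) (ι-mono (ZP.i<j⇒suc[i]≤j b<a)))
  (solve 2 (λ x y → (x :- y) :- con 1ℚ := x :- (y :+ con 1ℚ)) refl (ι a) (ι b))

ℕ-model : (P : NInterp) → OverN.StrictlyMonotone P → Compatible ℕ₀ Geℕ (algℕ P) R₄ → MonotoneModel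
ℕ-model P mono compat = record
  { δ = 1ℚ ; 0<δ = 0<1 ; polys = mapPolys (NInterp.polys P)
  ; Dom = Image ι ℕ₀
  ; Dom-nonNeg = λ { (z , 0≤z , refl) → ι-mono {Z.+ 0} {z} 0≤z }
  ; grid⊆Dom = λ n → Z.+ n , Z.+≤+ N.z≤n , *-identityˡ (ι (Z.+ n))
  ; closed = image-closed hom {ℕ₀} (NInterp.closed P)
  ; monotone = image-monotone hom {ℕ₀} {Gtℕ P} {λ y z → 1ℚ ≤ y - z} ι-gap ι-gap⁻¹ mono
  ; compatible = image-compatible hom {ℕ₀} {Geℕ} {λ y z → z ≤ y} {R₄} ι-mono compat }
  where hom = ι-hom (NInterp.polys P)

open FirstStep algℚ ℚ₀ Gtℚ Geℚ (λ P {y} {z} δ≤y-z → diff-0≤ {z} {y} (≤-trans (<⇒≤ (QInterp.δ-pos P)) δ≤y-z))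
  renaming (first-interpretation to first-ℚ-interpretation)
open FirstStep algℕ ℕ₀ Gtℕ Geℕ (λ _ → ZP.<⇒≤)
  renaming (first-interpretation to first-ℕ-interpretation)

lemma6p9 : ¬ OverQ.IncrPolyTerminating R₄ × ¬ OverN.IncrPolyTerminating R₄
lemma6p9 = not-over-ℚ , not-over-ℕ
  where
  not-over-ℚ : ¬ OverQ.IncrPolyTerminating R₄
  not-over-ℚ (_ , proof) =
    let P , mono , compat = first-ℚ-interpretation proof in NoMonotoneModel.absurd (ℚ-model P mono compat)
  not-over-ℕ : ¬ OverN.IncrPolyTerminating R₄
  not-over-ℕ (_ , proof) =
    let P , mono , compat = first-ℕ-interpretation proof in NoMonotoneModel.absurd (ℕ-model P mono compat)
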